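{- Let $\alpha:\mathbb{A}^\Delta\to(H,V)$ be a morphism into a finite forest algebra such that $H$ satisfies $\omega(h+g)+g+\omega(h+g)=\omega(h+g)$ for all $h,g\in H$, $V$ satisfies $(uv)^\omega v(uv)^\omega=(uv)^\omega$ for all $u,v\in V$, and the leaf completion of $\alpha$ is closed under saturation. Then there exists $k'\in\mathbb{N}$ such that for all $k\ge k'$, all sibling patterns $p,p'$ with $p\equiv_k p'$ and all forests $s$, the forests $p[\bar s]$ and $p'[\bar s]$ have the same forest type, i.e. $\alpha(p[\bar s])=\alpha(p'[\bar s])$.
   Context: $\mathbb{A}=(A,B)$ finite alphabet ($A$ leaf labels, $B$ inner labels). Trees/forests: each $a\in A$ is a tree; $t_1+\dots+t_k$ ($k\ge1$ trees) is a forest; $b(s)$ is a tree for $b\in B$, $s$ a forest. A context is a forest over $(A\cup\{\square\},B)$ with exactly one leaf labelled $\square$ (the port), not a root and without siblings; backbone = strict ancestors of the port. A multicontext is like a context with any number of ports (its arity), ordered left to right. A forest algebra $(H,V)$: finite semigroups ($H$ additive, not necessarily commutative; $V$ multiplicative) with a left action $V\times H\to H$, $w(vh)=(wv)h$, and for all $g,v$ elements $v+g,g+v\in V$ with $(v+g)h=vh+g$, $(g+v)h=g+vh$; $\mathbb{A}^\Delta$ is the free forest algebra (forests and contexts); morphisms are compatible pairs of semigroup morphisms; the image of a forest is its forest type. $\omega$ is a positive integer with $x^\omega$ and $\omega h$ idempotent for all $x\in V,h\in H$. The leaf completion of $\alpha$ is the morphism $(A\cup H,B)^\Delta\to(H,V)$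 extending $\alpha$ by mapping each new leaf label $h\in H$ to $h$. Sibling patterns: multicontexts each of whose trees is $a$, $b(\square)$ or $b(a)$ ($a\in A,b\in B$), excluding single trees $a\in A$; viewed as nonempty strings over the alphabet $\mathbb{A}_s$ of letters $a,b(\square),b(a)$; $b$ is the inner label. For a sibling pattern $q$ and forest $s$, $q[\bar s]$ is the forest obtained by placing $s$ at every port of $q$. For strings $p,p'$ over $\mathbb{A}_s$, $p\equiv_k p'$ means Duplicator has a winning strategy in the $k$-round two-pebble Ehrenfeucht–Fraïssé game for two-variable first-order logic with the order $<$ on strings: pebbles start on the first positions of $p$ and $p'$; each round Spoiler moves one pebble to a strictly earlier or strictly later position, and Duplicator must move the other pebble in the same direction to a position with the same letter. The sibling pattern of a node $x$ in a forest: with $t_1+\dots+t_\ell$ the subtrees rooted at siblings of $x$ (including $x$), it is $p_1+\dots+p_\ell$, $p_i=a$ if $t_i=a$, $b(a)$ if $t_i=b(a)$, $b(\square)$ if $t_i=b(s')$ with $s'$ not a single leaf. For a set $P$ of sibling patterns: a forest (context) is $P$-valid if it has more than one node and all its sibling patterns are in $P$; elements of $H$/$V$ are $P$-valid if images of $P$-valid forests/contexts; $h$ is $P$-reachable from $h'$ if $h=vh'$ for $P$-valid $v$; $P$ is branching if it has a pattern of arity $\ge2$, and then $H_P$ is the unique maximal class of mutually $P$-reachable $P$-valid forest types; $P$ is reduced if branching and every $P$-valid forest type is in $H_P$. For $X\subseteq H$, $(p,x)\equiv_k^X(p',x')$ is defined by the $k$-round $X$-relaxed game: pebbles start on $x,x'$;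 Spoiler moves a pebble strictly left or right to $z$ and Duplicator moves the other in the same direction to $z'$ with the same label if $z$ is not labelled $b(\square)$ or $b(a)$ with $\alpha(a)\in X$, and otherwise to a node of one of these two kinds with the same inner label; when pebbles lie on $b(c),b(c')$ with $c\ne c'\in A\cup\{\square\}$, Spoiler may select a pebble and Duplicator must place the other on a node labelled $b(\square)$; additionally $p,p'$ must use the same letters and $x,x'$ have the same label. A context $\Delta$ is $(P,k)$-saturated ($P$ branching reduced) if $P$-valid and every port-node $x$ of every $p\in P$ has a port-node $x'$ on the backbone of $\Delta$ with sibling pattern $p'$ and $(p,x)\equiv_k^{H_P}(p',x')$. A morphism is closed under saturation if for some $k$, for all branching reduced $P$, all $(P,k)$-saturated $\Delta$ and $h_1,h_2\in H_P$, $\alpha(\Delta)^\omega h_1=\alpha(\Delta)^\omega h_2$. -}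

module Defs where

open import Level using (0ℓ)
open import Data.Nat using (ℕ; zero; suc; _<_; _≤_)
open import Data.Fin using (Fin) renaming (zero to fzero; suc to fsuc; _<_ to _<ᶠ_)
open import Data.List using (List; []; _∷_; _++_; length; map; lookup)
open import Data.List.NonEmpty using (List⁺; toList) renaming (_∷_ to _∷⁺_)
open import Data.List.Relation.Unary.All using (All)
open import Data.List.Relation.Unary.Any using (Any)
open import Data.List.Membership.Propositional using (_∈_)
open import Data.Maybe using (Maybe; just; nothing)
open import Data.Product using (Σ; ∃; ∃-syntax; _×_; _,_)
open import Data.Sum using (_⊎_; inj₁; inj₂)
open import Data.Unit using (⊤)
open import Data.Empty using (⊥)
open import Relation.Nullary using (¬_)
open import Relation.Binary.PropositionalEquality using (_≡_; _≢_)
open import Function.Bundles using (_↔_)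

Finite : Set → Set
Finite X = ∃[ n ] (Fin n ↔ X)

-- Forests, trees and contexts over an alphabet (A , B)
-- (A = leaf labels, B = inner labels).  Forests are nonempty sequences
-- of trees.

mutual
  data Tree (A B : Set) : Set where
    leaf : A → Tree A B
    node : B → Forest A B → Tree A B

  data Forest (A B : Set) : Set where
    [_] : Tree A B → Forest A B
    _∷_ : Tree A B → Forest A B → Forest A B

-- A context  l + b(□) + r   or   l + b(C) + r  (C a context), where
-- l, r are (possibly empty) sequences of trees.  The port is a leaf that
-- is neither a root nor has siblings, so every context has exactly one
-- of these two shapes.
data Ctx (A B : Set) : Set where
  hole : List (Tree A B) → B → List (Tree A B) → Ctx A B
  sub  : List (Tree A B) → B → Ctx A B → List (Tree A B) → Ctx A B

module _ {A B : Set} where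

  toListF : Forest A B → List (Tree A B)
  toListF [ t ] = t ∷ []
  toListF (t ∷ s) = t ∷ toListF s

  _⊕_ : Forest A B → Forest A B → Forest A B
  [ t ] ⊕ s' = t ∷ s'
  (t ∷ s) ⊕ s' = t ∷ (s ⊕ s')

  prependL : List (Tree A B) → Forest A B → Forest A B
  prependL [] s = s
  prependL (t ∷ ts) s = t ∷ prependL ts s

  appendL : Forest A B → List (Tree A B) → Forest A B
  appendL s [] = s
  appendL [ t ] (t' ∷ ts) = t ∷ appendL [ t' ] ts
  appendL (t ∷ s) ts = t ∷ appendL s ts

  _·ᶜ_ : Ctx A B → Forest A B → Forest A B
  hole l b r ·ᶜ s = prependL l (appendL [ node b s ] r)
  sub l b C r ·ᶜ s = prependL l (appendL [ node b (C ·ᶜ s) ] r)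

  _∘ᶜ_ : Ctx A B → Ctx A B → Ctx A B
  hole l b r ∘ᶜ D = sub l b D r
  sub l b C r ∘ᶜ D = sub l b (C ∘ᶜ D) r

  _+ᶜᶠ_ : Ctx A B → Forest A B → Ctx A B
  hole l b r +ᶜᶠ s = hole l b (r ++ toListF s)
  sub l b C r +ᶜᶠ s = sub l b C (r ++ toListF s)

  _+ᶠᶜ_ : Forest A B → Ctx A B → Ctx A B
  s +ᶠᶜ hole l b r = hole (toListF s ++ l) b r
  s +ᶠᶜ sub l b C r = sub (toListF s ++ l) b C r

  -- number of nodes (for contexts, the port counts as a node)
  mutual
    sizeT : Tree A B → ℕ
    sizeT (leaf a) = 1
    sizeT (node b s) = suc (sizeF s)

    sizeF : Forest A B → ℕ
    sizeF [ t ] = sizeT t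
    sizeF (t ∷ s) = sizeT t Data.Nat.+ sizeF s

  sizeL : List (Tree A B) → ℕ
  sizeL [] = 0
  sizeL (t ∷ ts) = sizeT t Data.Nat.+ sizeL ts

  sizeC : Ctx A B → ℕ
  sizeC (hole l b r) = sizeL l Data.Nat.+ (2 Data.Nat.+ sizeL r)
  sizeC (sub l b C r) = sizeL l Data.Nat.+ (suc (sizeC C) Data.Nat.+ sizeL r)

module _ {A A' B : Set} (f : A → A') where
  mutual
    relabelT : Tree A B → Tree A' B
    relabelT (leaf a) = leaf (f a)
    relabelT (node b s) = node b (relabelF s)

    relabelF : Forest A B → Forest A' B
    relabelF [ t ] = [ relabelT t ]
    relabelF (t ∷ s) = relabelT t ∷ relabelF s

  relabelL : List (Tree A B) → List (Tree A' B)
  relabelL [] = []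
  relabelL (t ∷ ts) = relabelT t ∷ relabelL ts

  relabelC : Ctx A B → Ctx A' B
  relabelC (hole l b r) = hole (relabelL l) b (relabelL r)
  relabelC (sub l b C r) = sub (relabelL l) b (relabelC C) (relabelL r)

record ForestAlgebra : Set₁ where
  field
    H V : Set
    _+_ : H → H → H
    _·_ : V → V → V
    act : V → H → H
    _⊞_ : V → H → V
    _⊟_ : H → V → V
    +-assoc : ∀ x y z → (x + y) + z ≡ x + (y + z)
    ·-assoc : ∀ x y z → (x · y) · z ≡ x · (y · z)
    act-· : ∀ w v h → act w (act v h) ≡ act (w · v) h
    act-⊞ : ∀ v g h → act (v ⊞ g) h ≡ act v h + g
    act-⊟ : ∀ g v h → act (g ⊟ v) h ≡ g + act v h

  -- x^n for n ≥ 1 (the value at n = 0 is an unused junk value x)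
  powV : V → ℕ → V
  powV x zero = x
  powV x (suc zero) = x
  powV x (suc (suc n)) = x · powV x (suc n)

  -- n h = h + ... + h (n ≥ 1; junk value h at n = 0)
  mulH : ℕ → H → H
  mulH zero h = h
  mulH (suc zero) h = h
  mulH (suc (suc n)) h = h + mulH (suc n) h

FiniteFA : ForestAlgebra → Set
FiniteFA FA = Finite (ForestAlgebra.H FA) × Finite (ForestAlgebra.V FA)

IsOmega : ForestAlgebra → ℕ → Set
IsOmega FA ω = 0 < ω
  × (∀ x → powV x ω · powV x ω ≡ powV x ω)
  × (∀ h → mulH ω h + mulH ω h ≡ mulH ω h)
  where open ForestAlgebra FA

record Morphism (A B : Set) (FA : ForestAlgebra) : Set where
  open ForestAlgebra FA
  field
    fH : Forest A B → H
    fV : Ctx A B → V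
    hom-+ : ∀ s t → fH (s ⊕ t) ≡ fH s + fH t
    hom-· : ∀ C D → fV (C ∘ᶜ D) ≡ fV C · fV D
    hom-act : ∀ C s → fH (C ·ᶜ s) ≡ act (fV C) (fH s)
    hom-⊞ : ∀ C s → fV (C +ᶜᶠ s) ≡ fV C ⊞ fH s
    hom-⊟ : ∀ s C → fV (s +ᶠᶜ C) ≡ fH s ⊟ fV C

IsLeafCompletion : {A B : Set} {FA : ForestAlgebra} →
  Morphism A B FA → Morphism (A ⊎ ForestAlgebra.H FA) B FA → Set
IsLeafCompletion {A} {B} {FA} α β =
    (∀ (s : Forest A B) → fH β (relabelF inj₁ s) ≡ fH α s)
  × (∀ (C : Ctx A B) → fV β (relabelC inj₁ C) ≡ fV α C)
  × (∀ h → fH β [ leaf (inj₂ h) ] ≡ h)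
  where open Morphism

data Letter (A B : Set) : Set where
  leafL     : A → Letter A B
  portL     : B → Letter A B
  leafChild : B → A → Letter A B

Pattern : Set → Set → Set
Pattern A B = List⁺ (Letter A B)

IsSibPattern : {A B : Set} → Pattern A B → Set
IsSibPattern {A} p = ¬ (∃[ a ] (p ≡ (leafL a ∷⁺ [])))

module _ {A B : Set} where

  isPortLetter : Letter A B → Set
  isPortLetter l = ∃[ b ] (l ≡ portL b)

  arity : Pattern A B → ℕ
  arity p = cnt (toList p)
    where
      cnt : List (Letter A B) → ℕ
      cnt [] = 0
      cnt (leafL _ ∷ xs) = cnt xs
      cnt (portL _ ∷ xs) = suc (cnt xs)
      cnt (leafChild _ _ ∷ xs) = cnt xs

  letterTree : Letter A B → Forest A B → Tree A B
  letterTree (leafL a) s = leaf a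
  letterTree (portL b) s = node b s
  letterTree (leafChild b a) s = node b [ leaf a ]

  fillL : Letter A B → List (Letter A B) → Forest A B → Forest A B
  fillL x [] s = [ letterTree x s ]
  fillL x (y ∷ ys) s = letterTree x s ∷ fillL y ys s

  fill : Pattern A B → Forest A B → Forest A B
  fill (x ∷⁺ xs) s = fillL x xs s

  letterOf : Tree A B → Letter A B
  letterOf (leaf a) = leafL a
  letterOf (node b [ leaf a ]) = leafChild b a
  letterOf (node b s) = portL b

  patF : Forest A B → List (Letter A B)
  patF [ t ] = letterOf t ∷ []
  patF (t ∷ s) = letterOf t ∷ patF s

  patL : List (Tree A B) → List (Letter A B)
  patL = map letterOf

  -- two-pebble EF game for FO² with < on strings

  Win : (xs ys : List (Letter A B)) → ℕ → Fin (length xs) → Fin (length ys) → Set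
  Win xs ys zero i j = ⊤
  Win xs ys (suc k) i j =
      (∀ i' → i' <ᶠ i → ∃[ j' ] (j' <ᶠ j × lookup xs i' ≡ lookup ys j' × Win xs ys k i' j'))
    × (∀ i' → i <ᶠ i' → ∃[ j' ] (j <ᶠ j' × lookup xs i' ≡ lookup ys j' × Win xs ys k i' j'))
    × (∀ j' → j' <ᶠ j → ∃[ i' ] (i' <ᶠ i × lookup xs i' ≡ lookup ys j' × Win xs ys k i' j'))
    × (∀ j' → j <ᶠ j' → ∃[ i' ] (i <ᶠ i' × lookup xs i' ≡ lookup ys j' × Win xs ys k i' j'))

  -- p ≡_k p' (pebbles start on the first positions, which carry the same letter)
  EquivK : ℕ → Pattern A B → Pattern A B → Set
  EquivK k p p' = lookup (toList p) fzero ≡ lookup (toList p') fzero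
                × Win (toList p) (toList p') k fzero fzero

  -- X-relaxed game, relative to a map  leafType : A → H  (a ↦ α(a))

  module Relaxed {H : Set} (leafType : A → H) (X : H → Set) where

    RelaxedB : B → Letter A B → Set
    RelaxedB b l = (l ≡ portL b) ⊎ (∃[ a ] (l ≡ leafChild b a × X (leafType a)))

    Compat : Letter A B → Letter A B → Set
    Compat l l' = (l ≡ l') ⊎ (∃[ b ] (RelaxedB b l × RelaxedB b l'))

    bc : B → Maybe A → Letter A B
    bc b nothing = portL b
    bc b (just a) = leafChild b a

    DiffB : B → Letter A B → Letter A B → Set
    DiffB b l l' = ∃[ c ] ∃[ c' ] (c ≢ c' × l ≡ bc b c × l' ≡ bc b c')

    RWin : (xs ys : List (Letter A B)) → ℕ → Fin (length xs) → Fin (length ys) → Set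
    RWin xs ys zero i j = ⊤
    RWin xs ys (suc k) i j =
        (∀ i' → i' <ᶠ i → ∃[ j' ] (j' <ᶠ j × Compat (lookup xs i') (lookup ys j') × RWin xs ys k i' j'))
      × (∀ i' → i <ᶠ i' → ∃[ j' ] (j <ᶠ j' × Compat (lookup xs i') (lookup ys j') × RWin xs ys k i' j'))
      × (∀ j' → j' <ᶠ j → ∃[ i' ] (i' <ᶠ i × Compat (lookup xs i') (lookup ys j') × RWin xs ys k i' j'))
      × (∀ j' → j <ᶠ j' → ∃[ i' ] (i <ᶠ i' × Compat (lookup xs i') (lookup ys j') × RWin xs ys k i' j'))
      × (∀ b → DiffB b (lookup xs i) (lookup ys j) →
            (∃[ j' ] (lookup ys j' ≡ portL b × RWin xs ys k i j'))
          × (∃[ i' ] (lookup xs i' ≡ portL b × RWin xs ys k i' j)))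

    SameLetters : List (Letter A B) → List (Letter A B) → Set
    SameLetters xs ys = ∀ l → (l ∈ xs → l ∈ ys) × (l ∈ ys → l ∈ xs)

    RelEquiv : ℕ → (xs : List (Letter A B)) → Fin (length xs)
                 → (ys : List (Letter A B)) → Fin (length ys) → Set
    RelEquiv k xs i ys j = SameLetters xs ys × lookup xs i ≡ lookup ys j × RWin xs ys k i j

  module Valid (P : Pattern A B → Set) where

    -- sibling lists consisting of a single leaf are represented by the
    -- letter b(a) of their parent and impose no condition
    mutual
      OKT : Tree A B → Set
      OKT (leaf a) = ⊤
      OKT (node b s) = OKF s

      OKF : Forest A B → Set
      OKF [ leaf a ] = ⊤
      OKF [ node b s ] = P (letterOf (node b s) ∷⁺ []) × OKF s
      OKF (t ∷ s) = P (letterOf t ∷⁺ patF s) × OKT t × AllOK s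

      AllOK : Forest A B → Set
      AllOK [ t ] = OKT t
      AllOK (t ∷ s) = OKT t × AllOK s

    PValidF : Forest A B → Set
    PValidF s = 1 < sizeF s × OKF s

    rootPat : List (Tree A B) → B → List (Tree A B) → Pattern A B
    rootPat [] b r = portL b ∷⁺ patL r
    rootPat (t ∷ l) b r = letterOf t ∷⁺ (patL l ++ portL b ∷ patL r)

    OKC : Ctx A B → Set
    OKC (hole l b r) = P (rootPat l b r) × All OKT l × All OKT r
    OKC (sub l b C r) = P (rootPat l b r) × All OKT l × All OKT r × OKC C

    PValidC : Ctx A B → Set
    PValidC C = 1 < sizeC C × OKC C

  pos : (l : List (Letter A B)) (c : Letter A B) (r : List (Letter A B)) → Fin (length (l ++ c ∷ r))
  pos [] c r = fzero
  pos (x ∷ l) c r = fsuc (pos l c r)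

  PointedPattern : Set
  PointedPattern = Σ (List (Letter A B)) (λ xs → Fin (length xs))

  backbone : Ctx A B → List PointedPattern
  backbone (hole l b r) = (patL l ++ portL b ∷ patL r , pos (patL l) (portL b) (patL r)) ∷ []
  backbone (sub l b C r) = (patL l ++ portL b ∷ patL r , pos (patL l) (portL b) (patL r)) ∷ backbone C

module _ {A B : Set} {FA : ForestAlgebra} (β : Morphism A B FA) (P : Pattern A B → Set) where
  open ForestAlgebra FA
  open Morphism β
  open Valid P

  PValidH : H → Set
  PValidH h = ∃[ s ] (PValidF s × fH s ≡ h)

  PValidV : V → Set
  PValidV v = ∃[ C ] (PValidC C × fV C ≡ v)

  PReach : H → H → Set
  PReach h h' = ∃[ v ] (PValidV v × h ≡ act v h')

  Branching : Set
  Branching = ∃[ p ] (P p × 2 ≤ arity p)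

  -- h lies in the (unique, for branching P) maximal class of mutually
  -- P-reachable P-valid forest types
  InHP : H → Set
  InHP h = PValidH h × (∀ g → PValidH g → PReach g h → PReach h g)

  Reduced : Set
  Reduced = Branching × (∀ h → PValidH h → InHP h)

  Saturated : ℕ → Ctx A B → Set
  Saturated k Δ = PValidC Δ ×
    (∀ p → P p → ∀ (x : Fin (length (toList p))) → isPortLetter (lookup (toList p) x) →
       Any (λ q → Relaxed.RelEquiv (λ a → fH [ leaf a ]) InHP k (toList p) x (Σ.proj₁ q) (Σ.proj₂ q))
           (backbone Δ))

ClosedUnderSaturation : {A B : Set} {FA : ForestAlgebra} → ℕ → Morphism A B FA → Set₁
ClosedUnderSaturation {A} {B} {FA} ω β =
  ∃[ k ] (∀ (P : Pattern A B → Set) → (∀ p → P p → IsSibPattern p) →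
    Reduced β P → ∀ Δ → Saturated β P k Δ → ∀ h₁ h₂ → InHP β P h₁ → InHP β P h₂ →
    act (powV (fV Δ) ω) h₁ ≡ act (powV (fV Δ) ω) h₂)
  where open ForestAlgebra FA
        open Morphism β

HIdentity : ForestAlgebra → ℕ → Set
HIdentity FA ω = ∀ h g → (mulH ω (h + g) + g) + mulH ω (h + g) ≡ mulH ω (h + g)
  where open ForestAlgebra FA

VIdentity : ForestAlgebra → ℕ → Set
VIdentity FA ω = ∀ u v → (powV (u · v) ω · v) · powV (u · v) ω ≡ powV (u · v) ω
  where open ForestAlgebra FA

_⊎ᴴ_ : Set → ForestAlgebra → Set
A ⊎ᴴ FA = A ⊎ ForestAlgebra.H FA

module Submission where

-- Adjoining a unit to H gives a monoid H¹ in the variety DA, and the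
-- type of p[s̄] is the product in H¹ of the types of the trees of p[s̄].  So
-- the lemma is an instance of the classical fact that a finite DA monoid
-- does not distinguish words that are FO²-equivalent for enough rounds,
-- proved by induction on the number of letters:
--   1. algebra of DA: idempotents (uv)^ω absorb every product over the
--      letters of uv, and N blocks with full content C pump (pigeonhole);
--   2. the two-pebble game on intervals of words, and its restriction to
--      both sides of matching first (or last) occurrences of a letter;
--   3. search for first/last occurrences and for full prefixes/suffixes;
--   4. the induction: cut N full blocks off both ends of the two words;
--      the remaining middles are irrelevant between the stable products;
--   5. instantiation with H¹ and sibling patterns.

open import Defs
open import Data.Nat using (ℕ; _≤_)
open import Data.Product using (Σ; ∃-syntax; _×_)
open import Relation.Binary.PropositionalEquality using (_≡_)

open import Level using (0ℓ)
open import Data.Nat using (zero; suc; _+_; _∸_; _<_; z≤n; s≤s; _<?_; _≤?_)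
open import Data.Nat.Properties
  using ( ≤-refl; ≤-reflexive; ≤-trans; ≤-pred; <-trans; <-≤-trans; ≤-<-trans; <⇒≤; <⇒≱; ≰⇒>; ≮⇒≥; n≮0
        ; <-cmp; n<1+n; n≤1+n; m≤m+n; m≤n⇒m≤1+n; m<n⇒m<1+n; m<1+n⇒m≤n; m<1+n⇒m<n∨m≡n; m≤n⇒∃[o]m+o≡n
        ; +-suc; +-assoc; +-identityʳ; +-monoʳ-<; +-∸-assoc; m+[n∸m]≡n; m+n∸m≡n; n∸n≡0; m≤n⇒m∸n≡0 )
open import Data.Product using (_,_; proj₁; proj₂)
open import Data.Sum using (_⊎_; inj₁; inj₂)
open import Data.Unit using (⊤; tt)
open import Data.Empty using (⊥-elim)
open import Data.Maybe using (Maybe; just; nothing)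
open import Data.Maybe.Properties using (just-injective)
open import Data.Fin using (Fin; toℕ)
import Data.Fin as Fin
import Data.Fin.Properties as Finₚ
open import Data.List using (List; []; _∷_; length; filter; lookup; tabulate)
open import Data.List.NonEmpty using () renaming (_∷_ to _∷⁺_)
open import Data.List.Properties using (filter-notAll; length-tabulate)
open import Data.List.Membership.Propositional using (_∈_)
open import Data.List.Membership.Propositional.Properties using (∈-filter⁺; ∈-tabulate⁺)
open import Data.List.Relation.Unary.Any as Any using (here; there)
open import Data.List.Relation.Unary.All as All using (All; []; _∷_)
open import Function using (_∘_)
open import Function.Bundles using (_↔_; Inverse)
open import Function.Definitions using (Injective)
open import Relation.Nullary using (Dec; yes; no; ¬?)
open import Relation.Binary.Definitions using (DecidableEquality; tri<; tri≈; tri>)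
open import Algebra.Bundles using (Monoid)
open import Relation.Binary.PropositionalEquality
  using (_≢_; refl; sym; trans; cong; cong₂; subst; isEquivalence; module ≡-Reasoning)

power : {T : Set} → (T → T → T) → T → T → ℕ → T
power _*_ ε x zero    = ε
power _*_ ε x (suc n) = x * power _*_ ε x n

module Powers {T : Set} (_*_ : T → T → T) (ε : T)
              (assoc : ∀ x y z → (x * y) * z ≡ x * (y * z))
              (identityˡ : ∀ x → ε * x ≡ x) (identityʳ : ∀ x → x * ε ≡ x) where
  open ≡-Reasoning

  infixr 25 _^_
  _^_ : T → ℕ → T
  x ^ n = power _*_ ε x n

  ^-homo-+ : ∀ x a b → x ^ (a + b) ≡ x ^ a * x ^ b
  ^-homo-+ x zero    b = sym (identityˡ _)
  ^-homo-+ x (suc a) b = trans (cong (x *_) (^-homo-+ x a b)) (sym (assoc _ _ _))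

  ^-commute : ∀ x n → x ^ n * x ≡ x * x ^ n
  ^-commute x zero    = trans (identityˡ x) (sym (identityʳ x))
  ^-commute x (suc n) = trans (assoc _ _ _) (cong (x *_) (^-commute x n))

  ^-square : ∀ x n → (x * x) ^ n ≡ x ^ (n + n)
  ^-square x zero    = refl
  ^-square x (suc n) = begin
    (x * x) * (x * x) ^ n      ≡⟨ cong ((x * x) *_) (^-square x n) ⟩
    (x * x) * x ^ (n + n)      ≡⟨ assoc _ _ _ ⟩
    x * x ^ suc (n + n)        ≡⟨ cong (λ m → x * x ^ m) (sym (+-suc n n)) ⟩
    x ^ (suc n + suc n)        ∎

record DAMonoid : Set₁ where
  infixl 7 _*_
  field
    Carrier      : Set
    _*_          : Carrier → Carrier → Carrier
    ε            : Carrier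
    assoc        : ∀ x y z → x * y * z ≡ x * (y * z)
    identityˡ    : ∀ x → ε * x ≡ x
    identityʳ    : ∀ x → x * ε ≡ x
    ω            : ℕ
    ω-idempotent : ∀ x → power _*_ ε x ω * power _*_ ε x ω ≡ power _*_ ε x ω
    da-identity  : ∀ u v →
      power _*_ ε (u * v) ω * v * power _*_ ε (u * v) ω ≡ power _*_ ε (u * v) ω

module DAProperties (M : DAMonoid) where
  open DAMonoid M public
  open ≡-Reasoning

  -- the monoid as a stdlib bundle, for the monoid solver
  monoid : Monoid 0ℓ 0ℓ
  monoid = record
    { Carrier  = Carrier ; _≈_ = _≡_ ; _∙_ = _*_ ; ε = ε
    ; isMonoid = record
      { isSemigroup = record
        { isMagma = record { isEquivalence = isEquivalence ; ∙-cong = cong₂ _*_ }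
        ; assoc = assoc }
      ; identity = identityˡ , identityʳ } }

  open import Algebra.Solver.Monoid monoid using (solve; _⊜_) renaming (_⊕_ to _·_)

  open Powers _*_ ε assoc identityˡ identityʳ public

  infix 9 _^ω
  _^ω : Carrier → Carrier
  x ^ω = x ^ ω

  ^ω-square : ∀ x → (x * x) ^ω ≡ x ^ω
  ^ω-square x = trans (^-square x ω) (trans (^-homo-+ x ω ω) (ω-idempotent x))

  ^ω-absorbʳ : ∀ x → x ^ω * x ≡ x ^ω
  ^ω-absorbʳ x = begin
    x ^ω * x                      ≡⟨ cong (_* x) (sym (ω-idempotent x)) ⟩
    x ^ω * x ^ω * x               ≡⟨ assoc _ _ _ ⟩
    x ^ω * (x ^ω * x)             ≡⟨ cong (x ^ω *_) (^-commute x ω) ⟩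
    x ^ω * (x * x ^ω)             ≡⟨ sym (assoc _ _ _) ⟩
    x ^ω * x * x ^ω               ≡⟨ cong (λ e → e * x * e) (sym (^ω-square x)) ⟩
    (x * x) ^ω * x * (x * x) ^ω   ≡⟨ da-identity x x ⟩
    (x * x) ^ω                    ≡⟨ ^ω-square x ⟩
    x ^ω                          ∎

  ^ω-absorbˡ : ∀ x → x * x ^ω ≡ x ^ω
  ^ω-absorbˡ x = trans (sym (^-commute x ω)) (^ω-absorbʳ x)

  fixʳ-^ : ∀ {y z} → y ≡ y * z → ∀ n → y ≡ y * z ^ n
  fixʳ-^ {y} {z} fix zero    = sym (identityʳ y)
  fixʳ-^ {y} {z} fix (suc n) = begin
    y                 ≡⟨ fixʳ-^ fix n ⟩
    y * z ^ n         ≡⟨ cong (_* z ^ n) fix ⟩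
    y * z * z ^ n     ≡⟨ assoc _ _ _ ⟩
    y * z ^ suc n     ∎

  fixˡ-^ : ∀ {y z} → y ≡ z * y → ∀ n → y ≡ z ^ n * y
  fixˡ-^ {y} {z} fix zero    = sym (identityˡ y)
  fixˡ-^ {y} {z} fix (suc n) = begin
    y                 ≡⟨ fix ⟩
    z * y             ≡⟨ cong (z *_) (fixˡ-^ fix n) ⟩
    z * (z ^ n * y)   ≡⟨ sym (assoc _ _ _) ⟩
    z ^ suc n * y     ∎

  -- (ab)^ω = a (ba)^ω b, from (ab)^(n+1) = a (ba)^n b and aperiodicity
  ^-shift : ∀ a b n → (a * b) ^ suc n ≡ a * ((b * a) ^ n * b)
  ^-shift a b zero    = trans (identityʳ _) (cong (a *_) (sym (identityˡ b)))
  ^-shift a b (suc n) = begin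
    a * b * (a * b) ^ suc n           ≡⟨ cong (a * b *_) (^-shift a b n) ⟩
    a * b * (a * ((b * a) ^ n * b))   ≡⟨ solve 3 (λ A B P → (A · B) · (A · (P · B)) ⊜ A · (((B · A) · P) · B))
                                                refl a b ((b * a) ^ n) ⟩
    a * ((b * a) ^ suc n * b)         ∎

  ^ω-conjugate : ∀ a b → (a * b) ^ω ≡ a * ((b * a) ^ω * b)
  ^ω-conjugate a b = trans (sym (^ω-absorbˡ (a * b))) (^-shift a b ω)

  infix 4 _absorbs_
  _absorbs_ : Carrier → Carrier → Set
  e absorbs x = e * x * e ≡ e

  ^ω-absorbs-prefix : ∀ p q → (p * q) ^ω absorbs p
  ^ω-absorbs-prefix p q = begin
    e * p * e                         ≡⟨ cong (λ x → x * p * x) (^ω-conjugate p q) ⟩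
    p * (f * q) * p * (p * (f * q))   ≡⟨ solve 4 (λ P F Q X → (((P · (F · Q)) · P) · X) ⊜ (P · (F · (Q · P))) · X)
                                                refl p f q (p * (f * q)) ⟩
    p * (f * (q * p)) * (p * (f * q)) ≡⟨ cong (λ x → p * x * (p * (f * q))) (^ω-absorbʳ (q * p)) ⟩
    p * f * (p * (f * q))             ≡⟨ solve 4 (λ P F Q X → (P · F) · (P · (F · Q)) ⊜ P · (((F · P) · F) · Q))
                                                refl p f q (p * (f * q)) ⟩
    p * (f * p * f * q)               ≡⟨ cong (λ x → p * (x * q)) (da-identity q p) ⟩
    p * (f * q)                       ≡⟨ sym (^ω-conjugate p q) ⟩
    e                                 ∎
    where
      e f : Carrier
      e = (p * q) ^ω
      f = (q * p) ^ω

  absorbs-square : ∀ {e x} → e absorbs x → e absorbs x * x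
  absorbs-square {e} {x} exe = begin
    e * (x * x) * e           ≡⟨ cong (λ z → z * (x * x) * e) e≡ye ⟩
    y ^ω * e * (x * x) * e    ≡⟨ solve 3 (λ Y E X → ((Y · E) · (X · X)) · E ⊜ (Y · (E · X)) · (X · E))
                                        refl (y ^ω) e x ⟩
    y ^ω * y * (x * e)        ≡⟨ cong (_* (x * e)) (^ω-absorbʳ y) ⟩
    y ^ω * (x * e)            ≡⟨ cong (λ z → y ^ω * (x * z)) e≡ye ⟩
    y ^ω * (x * (y ^ω * e))   ≡⟨ solve 3 (λ Y E X → Y · (X · (Y · E)) ⊜ ((Y · X) · Y) · E) refl (y ^ω) e x ⟩
    y ^ω * x * y ^ω * e       ≡⟨ cong (_* e) (da-identity e x) ⟩
    y ^ω * e                  ≡⟨ sym e≡ye ⟩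
    e                         ∎
    where
      y : Carrier
      y = e * x
      e≡ye : e ≡ y ^ω * e
      e≡ye = fixˡ-^ (sym exe) ω

  absorbs-* : ∀ {e s t} → e absorbs s → e absorbs t → e absorbs s * t
  absorbs-* {e} {s} {t} ese ete = begin
    e * (s * t) * e       ≡⟨ solve 3 (λ E S T → (E · (S · T)) · E ⊜ (E · S) · (T · E)) refl e s t ⟩
    e * s * (t * e)       ≡⟨ cong₂ _*_ (sym ex≡es) (sym xe≡te) ⟩
    e * x * (x * e)       ≡⟨ solve 2 (λ E X → (E · X) · (X · E) ⊜ (E · (X · X)) · E) refl e x ⟩
    e * (x * x) * e       ≡⟨ absorbs-square (trans (cong (_* e) ex≡es) ese) ⟩
    e                     ∎
    where
      x : Carrier
      x = t * (e * s)
      ex≡es : e * x ≡ e * s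
      ex≡es = trans (solve 3 (λ E S T → E · (T · (E · S)) ⊜ ((E · T) · E) · S) refl e s t) (cong (_* s) ete)
      xe≡te : x * e ≡ t * e
      xe≡te = trans (solve 3 (λ E S T → (T · (E · S)) · E ⊜ T · ((E · S) · E)) refl e s t) (cong (t *_) ese)

  ^ω-absorbs-factor : ∀ a s b → (a * s * b) ^ω absorbs s
  ^ω-absorbs-factor a s b = begin
    e * s * e                                 ≡⟨ cong (λ x → x * s * x) (^ω-conjugate (a * s) b) ⟩
    a * s * (f * b) * s * (a * s * (f * b))   ≡⟨ solve 4 (λ A S F B →
                                                   (((A · S) · (F · B)) · S) · ((A · S) · (F · B))
                                                 ⊜ (A · S) · (((F · ((B · S) · (A · S))) · F) · B))
                                                 refl a s f b ⟩
    a * s * (f * (b * s * (a * s)) * f * b)   ≡⟨ cong (λ x → a * s * (x * b)) f-absorbs ⟩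
    a * s * (f * b)                           ≡⟨ sym (^ω-conjugate (a * s) b) ⟩
    e                                         ∎
    where
      e f : Carrier
      e = (a * s * b) ^ω
      f = (b * (a * s)) ^ω
      f-absorbs-s : f absorbs s
      f-absorbs-s = subst (λ z → z ^ω * s * z ^ω ≡ z ^ω) (assoc b a s) (da-identity (b * a) s)
      f-absorbs : f absorbs b * s * (a * s)
      f-absorbs = absorbs-* (absorbs-* (^ω-absorbs-prefix b (a * s)) f-absorbs-s) (da-identity b (a * s))

  module Content {S : Set} (letter : S → Carrier) where

    Contains : List S → Carrier → Set
    Contains C y = ∀ c → c ∈ C → ∃[ x ] ∃[ z ] (y ≡ x * letter c * z)

    data Generated (C : List S) : Carrier → Set where
      []ᵍ  : Generated C ε
      _∷ᵍ_ : ∀ {c m} → c ∈ C → Generated C m → Generated C (letter c * m)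

    generated-letter : ∀ {C c} → c ∈ C → Generated C (letter c)
    generated-letter {c = c} c∈C = subst (Generated _) (identityʳ (letter c)) (c∈C ∷ᵍ []ᵍ)

    generated-* : ∀ {C a b} → Generated C a → Generated C b → Generated C (a * b)
    generated-* {b = b} []ᵍ gb = subst (Generated _) (sym (identityˡ b)) gb
    generated-* {b = b} (_∷ᵍ_ {c} {m} c∈ ga) gb =
      subst (Generated _) (sym (assoc (letter c) m b)) (c∈ ∷ᵍ generated-* ga gb)

    generated-^ : ∀ {C a} → Generated C a → ∀ n → Generated C (a ^ n)
    generated-^ ga zero    = []ᵍ
    generated-^ ga (suc n) = generated-* ga (generated-^ ga n)

    contains-*ʳ : ∀ {C y} z → Contains C y → Contains C (y * z)
    contains-*ʳ z cy c c∈ with cy c c∈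
    ... | a , b , y≡ = a , b * z , trans (cong (_* z) y≡) (assoc _ _ _)

    contains-*ˡ : ∀ {C y} z → Contains C y → Contains C (z * y)
    contains-*ˡ z cy c c∈ with cy c c∈
    ... | a , b , y≡ = z * a , b ,
      trans (cong (z *_) y≡) (solve 4 (λ Z A X B → Z · ((A · X) · B) ⊜ ((Z · A) · X) · B) refl z a (letter c) b)

    ^ω-absorbs-generated : ∀ {C y m} → Contains C y → Generated C m → y ^ω absorbs m
    ^ω-absorbs-generated {y = y} cy []ᵍ = trans (cong (_* y ^ω) (identityʳ _)) (ω-idempotent y)
    ^ω-absorbs-generated cy (_∷ᵍ_ {c} c∈ gm) with cy c c∈
    ... | a , b , y≡ =
      absorbs-* (subst (λ z → z ^ω absorbs letter c) (sym y≡) (^ω-absorbs-factor a (letter c) b))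
                (^ω-absorbs-generated cy gm)

    ^ω-bridge : ∀ {C z z' m} → Contains C z → Generated C z → Contains C z' → Generated C z' →
      Generated C m → z ^ω * m * z' ^ω ≡ z ^ω * z' ^ω
    ^ω-bridge {C} {z} {z'} {m} cz gz cz' gz' gm = begin
      e * m * f                 ≡⟨ cong (e * m *_) (sym f-absorbs-e) ⟩
      e * m * (f * e * f)       ≡⟨ solve 3 (λ E M F → (E · M) · ((F · E) · F) ⊜ ((E · (M · F)) · E) · F) refl e m f ⟩
      e * (m * f) * e * f       ≡⟨ cong (_* f) (absorbs-* (^ω-absorbs-generated cz gm) e-absorbs-f) ⟩
      e * f                     ∎
      where
        e f : Carrier
        e = z ^ω
        f = z' ^ω
        e-absorbs-f : e absorbs f
        e-absorbs-f = ^ω-absorbs-generated cz (generated-^ gz' ω)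
        f-absorbs-e : f absorbs e
        f-absorbs-e = ^ω-absorbs-generated cz' (generated-^ gz ω)

    record StableRight (C : List S) (y : Carrier) : Set where
      field
        x z r       : Carrier
        z-contains  : Contains C z
        z-generated : Generated C z
        r-generated : Generated C r
        x-fixed     : x ≡ x * z
        y≡xr        : y ≡ x * r

    record StableLeft (C : List S) (y : Carrier) : Set where
      field
        x z l       : Carrier
        z-contains  : Contains C z
        z-generated : Generated C z
        l-generated : Generated C l
        x-fixed     : x ≡ z * x
        y≡lx        : y ≡ l * x

    stable-context : ∀ {C p q m m'} → StableRight C p → StableLeft C q →
      Generated C m → Generated C m' → p * (m * q) ≡ p * (m' * q)
    stable-context {C} {p} {q} sp sq gm gm' = trans (normal-form gm) (sym (normal-form gm'))
      where
        open StableRight sp using (x; z; r; z-contains; z-generated; r-generated; x-fixed; y≡xr)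
        open StableLeft sq using () renaming
          (x to x'; z to z'; l to l; z-contains to z'-contains; z-generated to z'-generated;
           l-generated to l-generated; x-fixed to x'-fixed; y≡lx to y≡lx')
        normal-form : ∀ {m} → Generated C m → p * (m * q) ≡ x * (z ^ω * z' ^ω) * x'
        normal-form {m} gm = begin
          p * (m * q)                             ≡⟨ cong₂ (λ a b → a * (m * b)) y≡xr y≡lx' ⟩
          x * r * (m * (l * x'))                  ≡⟨ cong₂ (λ a b → a * r * (m * (l * b))) (fixʳ-^ x-fixed ω) (fixˡ-^ x'-fixed ω) ⟩
          x * z ^ω * r * (m * (l * (z' ^ω * x'))) ≡⟨ solve 7 (λ X E R M L F Y → ((X · E) · R) · (M · (L · (F · Y)))
                                                              ⊜ (X · ((E · ((R · M) · L)) · F)) · Y)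
                                                       refl x (z ^ω) r m l (z' ^ω) x' ⟩
          x * (z ^ω * (r * m * l) * z' ^ω) * x'   ≡⟨ cong (λ a → x * a * x')
                                                       (^ω-bridge z-contains z-generated z'-contains z'-generated
                                                         (generated-* (generated-* r-generated gm) l-generated)) ⟩
          x * (z ^ω * z' ^ω) * x'                 ∎

    prefixProduct : (ℕ → Carrier) → ℕ → Carrier
    prefixProduct b zero    = ε
    prefixProduct b (suc t) = b 0 * prefixProduct (b ∘ suc) t

    suffixProduct : (ℕ → Carrier) → ℕ → Carrier
    suffixProduct b zero    = ε
    suffixProduct b (suc t) = suffixProduct (b ∘ suc) t * b 0

    prefixProduct-+ : ∀ b i d → prefixProduct b (i + d) ≡ prefixProduct b i * prefixProduct (λ j → b (i + j)) d
    prefixProduct-+ b zero    d = sym (identityˡ _)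
    prefixProduct-+ b (suc i) d =
      trans (cong (b 0 *_) (prefixProduct-+ (b ∘ suc) i d)) (sym (assoc _ _ _))

    suffixProduct-+ : ∀ b i d → suffixProduct b (i + d) ≡ suffixProduct (λ j → b (i + j)) d * suffixProduct b i
    suffixProduct-+ b zero    d = sym (identityʳ _)
    suffixProduct-+ b (suc i) d =
      trans (cong (_* b 0) (suffixProduct-+ (b ∘ suc) i d)) (assoc _ _ _)

    prefixProduct-cong : ∀ {b b'} → (∀ j → b j ≡ b' j) → ∀ t → prefixProduct b t ≡ prefixProduct b' t
    prefixProduct-cong b≗b' zero    = refl
    prefixProduct-cong b≗b' (suc t) = cong₂ _*_ (b≗b' 0) (prefixProduct-cong (b≗b' ∘ suc) t)

    Blocks : List S → (ℕ → Carrier) → ℕ → Set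
    Blocks C b t = ∀ i → i < t → Contains C (b i) × Generated C (b i)

    blocks-shift : ∀ {C b t} → Blocks C b t → ∀ a s → a + s ≤ t → Blocks C (λ j → b (a + j)) s
    blocks-shift bs a s a+s≤t j j<s = bs (a + j) (<-≤-trans (+-monoʳ-< a j<s) a+s≤t)

    generated-prefixProduct : ∀ {C b t} → (∀ i → i < t → Generated C (b i)) → Generated C (prefixProduct b t)
    generated-prefixProduct {t = zero}  gs = []ᵍ
    generated-prefixProduct {t = suc t} gs =
      generated-* (gs 0 (s≤s z≤n)) (generated-prefixProduct (λ i i<t → gs (suc i) (s≤s i<t)))

    generated-suffixProduct : ∀ {C b t} → (∀ i → i < t → Generated C (b i)) → Generated C (suffixProduct b t)
    generated-suffixProduct {t = zero}  gs = []ᵍ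
    generated-suffixProduct {t = suc t} gs =
      generated-* (generated-suffixProduct (λ i i<t → gs (suc i) (s≤s i<t))) (gs 0 (s≤s z≤n))

    blocks-generated : ∀ {C b t} → Blocks C b t → ∀ i → i < t → Generated C (b i)
    blocks-generated bs i i<t = proj₂ (bs i i<t)

    -- In a monoid with at most N elements, N blocks over full content C
    -- already form a stable product (pigeonhole on the N + 1 partial products).
    module Pumping {N : ℕ} (code : Carrier → Fin N) (code-injective : Injective _≡_ _≡_ code) where

      collision : (f : ℕ → Carrier) → ∃[ i ] ∃[ d ] (i + suc d ≤ N × f i ≡ f (i + suc d))
      collision f with Finₚ.pigeonhole (n<1+n N) (λ (i : Fin (suc N)) → code (f (toℕ i)))
      ... | i , j , i<j , same-code with m≤n⇒∃[o]m+o≡n i<j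
      ...   | d , i+1+d≡j = toℕ i , d , subst (_≤ N) j≡ (≤-pred (Finₚ.toℕ<n j)) ,
                            subst (λ k → f (toℕ i) ≡ f k) j≡ (code-injective same-code)
        where
          j≡ : toℕ j ≡ toℕ i + suc d
          j≡ = trans (sym i+1+d≡j) (sym (+-suc (toℕ i) d))

      prefix-stable : ∀ {C b} → Blocks C b N → StableRight C (prefixProduct b N)
      prefix-stable {C} {b} bs with collision (prefixProduct b)
      ... | i , d , i+1+d≤N , same with m≤n⇒∃[o]m+o≡n i+1+d≤N
      ...   | o , i+1+d+o≡N = record
        { x = prefixProduct b i
        ; z = prefixProduct (λ j → b (i + j)) (suc d)
        ; r = prefixProduct (λ j → b (i + suc d + j)) o
        ; z-contains  = contains-*ʳ _ (proj₁ (period 0 (s≤s z≤n)))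
        ; z-generated = generated-prefixProduct (blocks-generated period)
        ; r-generated = generated-prefixProduct (blocks-generated rest)
        ; x-fixed = trans same (prefixProduct-+ b i (suc d))
        ; y≡xr    = trans (cong (prefixProduct b) (sym i+1+d+o≡N))
                      (trans (prefixProduct-+ b (i + suc d) o) (cong (_* prefixProduct (λ j → b (i + suc d + j)) o) (sym same)))
        }
        where
          period : Blocks C (λ j → b (i + j)) (suc d)
          period = blocks-shift bs i (suc d) i+1+d≤N
          rest : Blocks C (λ j → b (i + suc d + j)) o
          rest = blocks-shift bs (i + suc d) o (≤-reflexive i+1+d+o≡N)

      suffix-stable : ∀ {C b} → Blocks C b N → StableLeft C (suffixProduct b N)
      suffix-stable {C} {b} bs with collision (suffixProduct b)
      ... | i , d , i+1+d≤N , same with m≤n⇒∃[o]m+o≡n i+1+d≤N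
      ...   | o , i+1+d+o≡N = record
        { x = suffixProduct b i
        ; z = suffixProduct (λ j → b (i + j)) (suc d)
        ; l = suffixProduct (λ j → b (i + suc d + j)) o
        ; z-contains  = contains-*ˡ _ (proj₁ (period 0 (s≤s z≤n)))
        ; z-generated = generated-suffixProduct (blocks-generated period)
        ; l-generated = generated-suffixProduct (blocks-generated rest)
        ; x-fixed = trans same (suffixProduct-+ b i (suc d))
        ; y≡lx    = trans (cong (suffixProduct b) (sym i+1+d+o≡N))
                      (trans (suffixProduct-+ b (i + suc d) o) (cong (suffixProduct (λ j → b (i + suc d + j)) o *_) (sym same)))
        }
        where
          period : Blocks C (λ j → b (i + j)) (suc d)
          period = blocks-shift bs i (suc d) i+1+d≤N
          rest : Blocks C (λ j → b (i + suc d + j)) o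
          rest = blocks-shift bs (i + suc d) o (≤-reflexive i+1+d+o≡N)

-- Words are maps ℕ → S of which only the positions in an interval
-- [lo , hi) matter.
Range : ℕ → ℕ → ℕ → Set
Range lo hi p = lo ≤ p × p < hi

data Dir : Set where
  leftward rightward : Dir

Beyond : Dir → ℕ → ℕ → Set
Beyond leftward  p p' = p' < p
Beyond rightward p p' = p < p'

beyond-trans : ∀ d {p p' p''} → Beyond d p p' → Beyond d p' p'' → Beyond d p p''
beyond-trans leftward  p'<p p''<p' = <-trans p''<p' p'<p
beyond-trans rightward p<p' p'<p'' = <-trans p<p' p'<p''

beyond-trichotomy : ∀ d p q → Beyond d p q ⊎ p ≡ q ⊎ Beyond d q p
beyond-trichotomy leftward p q with <-cmp p q
... | tri< p<q _ _ = inj₂ (inj₂ p<q)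
... | tri≈ _ p≡q _ = inj₂ (inj₁ p≡q)
... | tri> _ _ q<p = inj₁ q<p
beyond-trichotomy rightward p q with <-cmp p q
... | tri< p<q _ _ = inj₁ p<q
... | tri≈ _ p≡q _ = inj₂ (inj₁ p≡q)
... | tri> _ _ q<p = inj₂ (inj₂ q<p)

beyond-after : ∀ d {a b c} → b ≡ a ⊎ Beyond d a b → Beyond d b c → Beyond d a c
beyond-after d (inj₁ refl) b→c = b→c
beyond-after d (inj₂ a→b)  b→c = beyond-trans d a→b b→c

NoneBeyond : {S : Set} (w : ℕ → S) (Z : ℕ → Set) → Dir → ℕ → S → Set
NoneBeyond w Z d i x = ∀ p → Z p → Beyond d i p → w p ≢ x

-- The two-pebble game for FO² on two words u and v whose positions are
-- restricted to the domains X and Y.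
module Game {S : Set} (u v : ℕ → S) where

  G : (X Y : ℕ → Set) → ℕ → ℕ → ℕ → Set
  G X Y zero    p q = ⊤
  G X Y (suc k) p q = ∀ d →
      (∀ p' → X p' → Beyond d p p' → ∃[ q' ] (Y q' × Beyond d q q' × u p' ≡ v q' × G X Y k p' q'))
    × (∀ q' → Y q' → Beyond d q q' → ∃[ p' ] (X p' × Beyond d p p' × u p' ≡ v q' × G X Y k p' q'))

  G-≤ : ∀ {X Y k k'} → k ≤ k' → ∀ {p q} → G X Y k' p q → G X Y k p q
  G-≤ z≤n         g   = tt
  G-≤ (s≤s k≤k') g d =
      (λ p' x b → let (q' , y , b' , e , g') = proj₁ (g d) p' x b in q' , y , b' , e , G-≤ k≤k' g')
    , (λ q' y b → let (p' , x , b' , e , g') = proj₂ (g d) q' y b in p' , x , b' , e , G-≤ k≤k' g')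

  Equiv : (X Y : ℕ → Set) → ℕ → Set
  Equiv X Y k = (∀ p → X p → ∃[ q ] (Y q × u p ≡ v q × G X Y k p q))
              × (∀ q → Y q → ∃[ p ] (X p × u p ≡ v q × G X Y k p q))

  Equiv-≤ : ∀ {X Y k k'} → k ≤ k' → Equiv X Y k' → Equiv X Y k
  Equiv-≤ k≤k' (forth , back) =
      (λ p x → let (q , y , e , g) = forth p x in q , y , e , G-≤ k≤k' g)
    , (λ q y → let (p , x , e , g) = back q y in p , x , e , G-≤ k≤k' g)

  Compatible : (X Y X' Y' : ℕ → Set) → Set
  Compatible X Y X' Y' = ∀ p q → X p → Y q → u p ≡ v q → G X Y 1 p q → (X' p → Y' q) × (Y' q → X' p)

  module Restrict {X Y X' Y' : ℕ → Set} (X'⊆X : ∀ {p} → X' p → X p) (Y'⊆Y : ∀ {q} → Y' q → Y q)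
                  (compatible : Compatible X Y X' Y') where

    restrict : ∀ k {p q} → X' p → Y' q → G X Y (suc k) p q → G X' Y' k p q
    restrict zero    _ _ _ = tt
    restrict (suc k) _ _ g d =
        (λ p' x' b → let (q' , y , b' , e , g') = proj₁ (g d) p' (X'⊆X x') b
                         y' = proj₁ (compatible p' q' (X'⊆X x') y e (G-≤ (s≤s z≤n) g')) x'
                     in q' , y' , b' , e , restrict k x' y' g')
      , (λ q' y' b → let (p' , x , b' , e , g') = proj₂ (g d) q' (Y'⊆Y y') b
                         x' = proj₂ (compatible p' q' x (Y'⊆Y y') e (G-≤ (s≤s z≤n) g')) y'
                     in p' , x' , b' , e , restrict k x' y' g')

    Equiv-restrict : ∀ k → Equiv X Y (suc k) → Equiv X' Y' k
    Equiv-restrict k (forth , back) =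
        (λ p x' → let (q , y , e , g) = forth p (X'⊆X x')
                      y' = proj₁ (compatible p q (X'⊆X x') y e (G-≤ (s≤s z≤n) g)) x'
                  in q , y' , e , restrict k x' y' g)
      , (λ q y' → let (p , x , e , g) = back q (Y'⊆Y y')
                      x' = proj₂ (compatible p q x (Y'⊆Y y') e (G-≤ (s≤s z≤n) g)) y'
                  in p , x' , e , restrict k x' y' g)

  -- if x occurs at i0 in u but not beyond it, a pebble beyond i0 is
  -- answered beyond every occurrence j0 of x in v (else Spoiler jumps to j0)
  stays-beyond : ∀ {X Y} d {i0 j0 x} → Y j0 → v j0 ≡ x → NoneBeyond u X d i0 x →
    ∀ {p q} → X p → Y q → u p ≡ v q → G X Y 1 p q → Beyond d i0 p → Beyond d j0 q
  stays-beyond d {i0} {j0} yj0 vj0≡x none {p} {q} xp yq up≡vq g i0→p with beyond-trichotomy d j0 q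
  ... | inj₁ j0→q        = j0→q
  ... | inj₂ (inj₁ refl) = ⊥-elim (none p xp i0→p (trans up≡vq vj0≡x))
  ... | inj₂ (inj₂ q→j0) with proj₂ (g d) j0 yj0 q→j0
  ...   | p' , xp' , p→p' , up'≡vj0 , _ = ⊥-elim (none p' xp' (beyond-trans d i0→p p→p') (trans up'≡vj0 vj0≡x))

  -- if x occurs at i0 in u and not beyond j0 in v, a pebble having i0
  -- beyond it is answered with j0 beyond it (else Spoiler jumps to i0)
  stays-before : ∀ {X Y} d {i0 j0 x} → X i0 → u i0 ≡ x → NoneBeyond v Y d j0 x →
    ∀ {p q} → Y q → G X Y 1 p q → Beyond d p i0 → Beyond d q j0
  stays-before d {i0} {j0} xi0 ui0≡x none {p} {q} yq g p→i0 with beyond-trichotomy d q j0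
  ... | inj₁ q→j0        = q→j0
  ... | inj₂ j0-not-past with proj₁ (g d) i0 xi0 p→i0
  ...   | q' , yq' , q→q' , ui0≡vq' , _ =
    ⊥-elim (none q' yq' (beyond-after d j0-not-past q→q') (trans (sym ui0≡vq') ui0≡x))

  sides-preserved : ∀ {X Y} d {i0 j0} → X i0 → Y j0 → u i0 ≡ v j0 →
    NoneBeyond u X d i0 (u i0) → NoneBeyond v Y d j0 (u i0) →
    ∀ {p q} → X p → Y q → u p ≡ v q → G X Y 1 p q → (p < i0 → q < j0) × (i0 < p → j0 < q)
  sides-preserved leftward  xi0 yj0 e noneᵘ noneᵛ xp yq up≡vq g =
    stays-beyond leftward yj0 (sym e) noneᵘ xp yq up≡vq g , stays-before leftward xi0 refl noneᵛ yq g
  sides-preserved rightward xi0 yj0 e noneᵘ noneᵛ xp yq up≡vq g =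
    stays-before rightward xi0 refl noneᵛ yq g , stays-beyond rightward yj0 (sym e) noneᵘ xp yq up≡vq g

G-swap : ∀ {S} (u v : ℕ → S) {X Y} k {p q} → Game.G u v X Y k p q → Game.G v u Y X k q p
G-swap u v zero    g = tt
G-swap u v (suc k) g d =
    (λ q' y b → let (p' , x , b' , e , g') = proj₂ (g d) q' y b in p' , x , b' , sym e , G-swap u v k g')
  , (λ p' x b → let (q' , y , b' , e , g') = proj₁ (g d) p' x b in q' , y , b' , sym e , G-swap u v k g')

cut : ∀ {S} (u v : ℕ → S) d {lo hi lo' hi' i0 j0 k} → Range lo hi i0 → Range lo' hi' j0 → u i0 ≡ v j0 →
  NoneBeyond u (Range lo hi) d i0 (u i0) → NoneBeyond v (Range lo' hi') d j0 (u i0) →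
  Game.Equiv u v (Range lo hi) (Range lo' hi') (suc k) →
  Game.Equiv u v (Range lo i0) (Range lo' j0) k × Game.Equiv u v (Range (suc i0) hi) (Range (suc j0) hi') k
cut u v d {lo} {hi} {lo'} {hi'} {i0} {j0} {k} ri0 rj0 e noneᵘ noneᵛ eqv =
    Game.Restrict.Equiv-restrict u v leftᵘ leftᵛ left-compatible k eqv
  , Game.Restrict.Equiv-restrict u v rightᵘ rightᵛ right-compatible k eqv
  where
    sides : ∀ {p q} → Range lo hi p → Range lo' hi' q → u p ≡ v q → Game.G u v (Range lo hi) (Range lo' hi') 1 p q →
      ((p < i0 → q < j0) × (i0 < p → j0 < q)) × ((q < j0 → p < i0) × (j0 < q → i0 < p))
    sides rp rq up≡vq g =
        Game.sides-preserved u v d ri0 rj0 e noneᵘ noneᵛ rp rq up≡vq g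
      , Game.sides-preserved v u d rj0 ri0 (sym e) (λ q r b vq≡ → noneᵛ q r b (trans vq≡ (sym e)))
          (λ p r b up≡ → noneᵘ p r b (trans up≡ (sym e))) rq rp (sym up≡vq) (G-swap u v 1 g)
    leftᵘ : ∀ {p} → Range lo i0 p → Range lo hi p
    leftᵘ (lo≤p , p<i0) = lo≤p , <-trans p<i0 (proj₂ ri0)
    leftᵛ : ∀ {q} → Range lo' j0 q → Range lo' hi' q
    leftᵛ (lo'≤q , q<j0) = lo'≤q , <-trans q<j0 (proj₂ rj0)
    rightᵘ : ∀ {p} → Range (suc i0) hi p → Range lo hi p
    rightᵘ (i0<p , p<hi) = ≤-trans (proj₁ ri0) (<⇒≤ i0<p) , p<hi
    rightᵛ : ∀ {q} → Range (suc j0) hi' q → Range lo' hi' q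
    rightᵛ (j0<q , q<hi') = ≤-trans (proj₁ rj0) (<⇒≤ j0<q) , q<hi'
    left-compatible : Game.Compatible u v (Range lo hi) (Range lo' hi') (Range lo i0) (Range lo' j0)
    left-compatible p q rp rq up≡vq g with sides rp rq up≡vq g
    ... | (p<i0⇒q<j0 , _) , (q<j0⇒p<i0 , _) =
      (λ (_ , p<i0) → proj₁ rq , p<i0⇒q<j0 p<i0) , (λ (_ , q<j0) → proj₁ rp , q<j0⇒p<i0 q<j0)
    right-compatible : Game.Compatible u v (Range lo hi) (Range lo' hi') (Range (suc i0) hi) (Range (suc j0) hi')
    right-compatible p q rp rq up≡vq g with sides rp rq up≡vq g
    ... | (_ , i0<p⇒j0<q) , (_ , j0<q⇒i0<p) =
      (λ (i0<p , _) → i0<p⇒j0<q i0<p , proj₂ rq) , (λ (j0<q , _) → j0<q⇒i0<p j0<q , proj₂ rp)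

module Occurrences {S : Set} (_≟_ : DecidableEquality S) (w : ℕ → S) where

  Occurs : ℕ → ℕ → S → Set
  Occurs lo hi x = ∃[ p ] (Range lo hi p × w p ≡ x)

  Absent : ℕ → ℕ → S → Set
  Absent lo hi x = ∀ p → Range lo hi p → w p ≢ x

  -- i is the occurrence of x in [lo , hi) furthest in direction d
  -- (the first one for leftward, the last one for rightward)
  Outermost : Dir → ℕ → ℕ → S → ℕ → Set
  Outermost d lo hi x i = Range lo hi i × w i ≡ x × NoneBeyond w (Range lo hi) d i x

  occurs-extendʳ : ∀ {lo hi hi' x} → hi ≤ hi' → Occurs lo hi x → Occurs lo hi' x
  occurs-extendʳ hi≤hi' (p , (lo≤p , p<hi) , wp≡x) = p , (lo≤p , <-≤-trans p<hi hi≤hi') , wp≡x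

  occurs-extendˡ : ∀ {lo lo' hi x} → lo' ≤ lo → Occurs lo hi x → Occurs lo' hi x
  occurs-extendˡ lo'≤lo (p , (lo≤p , p<hi) , wp≡x) = p , (≤-trans lo'≤lo lo≤p , p<hi) , wp≡x

  occursAt? : ∀ lo h x → (lo ≤ h × w h ≡ x) ⊎ (lo ≤ h → w h ≢ x)
  occursAt? lo h x with lo ≤? h | w h ≟ x
  ... | yes lo≤h | yes wh≡x = inj₁ (lo≤h , wh≡x)
  ... | yes _    | no wh≢x  = inj₂ (λ _ → wh≢x)
  ... | no lo≰h  | _        = inj₂ (λ lo≤h → ⊥-elim (lo≰h lo≤h))

  absent-extend : ∀ {lo h x} → Absent lo h x → (lo ≤ h → w h ≢ x) → Absent lo (suc h) x
  absent-extend absent not-at-h p (lo≤p , p<1+h) with m<1+n⇒m<n∨m≡n p<1+h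
  ... | inj₁ p<h  = absent p (lo≤p , p<h)
  ... | inj₂ refl = not-at-h lo≤p

  firstOccurrence : ∀ lo hi x → (∃[ i ] Outermost leftward lo hi x i) ⊎ Absent lo hi x
  firstOccurrence lo zero    x = inj₂ (λ p ())
  firstOccurrence lo (suc h) x with firstOccurrence lo h x
  ... | inj₁ (i , (lo≤i , i<h) , wi≡x , none) =
    inj₁ (i , (lo≤i , m<n⇒m<1+n i<h) , wi≡x , λ p (lo≤p , _) p<i → none p (lo≤p , <-trans p<i i<h) p<i)
  ... | inj₂ absent with occursAt? lo h x
  ...   | inj₁ (lo≤h , wh≡x) = inj₁ (h , (lo≤h , n<1+n h) , wh≡x , λ p (lo≤p , _) p<h → absent p (lo≤p , p<h))
  ...   | inj₂ not-at-h      = inj₂ (absent-extend absent not-at-h)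

  lastOccurrence : ∀ lo hi x → (∃[ i ] Outermost rightward lo hi x i) ⊎ Absent lo hi x
  lastOccurrence lo zero    x = inj₂ (λ p ())
  lastOccurrence lo (suc h) x with occursAt? lo h x
  ... | inj₁ (lo≤h , wh≡x) =
    inj₁ (h , (lo≤h , n<1+n h) , wh≡x , λ p (_ , p<1+h) h<p → ⊥-elim (<⇒≱ h<p (m<1+n⇒m≤n p<1+h)))
  ... | inj₂ not-at-h with lastOccurrence lo h x
  ...   | inj₂ absent = inj₂ (absent-extend absent not-at-h)
  ...   | inj₁ (i , (lo≤i , i<h) , wi≡x , none) = inj₁ (i , (lo≤i , m<n⇒m<1+n i<h) , wi≡x , none')
    where
      none' : NoneBeyond w (Range lo (suc h)) rightward i x
      none' p (lo≤p , p<1+h) i<p with m<1+n⇒m<n∨m≡n p<1+h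
      ... | inj₁ p<h  = none p (lo≤p , p<h) i<p
      ... | inj₂ refl = not-at-h lo≤p

  first : ∀ {lo hi x} → Occurs lo hi x → ∃[ i ] Outermost leftward lo hi x i
  first {lo} {hi} {x} (p , rp , wp≡x) with firstOccurrence lo hi x
  ... | inj₁ found  = found
  ... | inj₂ absent = ⊥-elim (absent p rp wp≡x)

  last : ∀ {lo hi x} → Occurs lo hi x → ∃[ i ] Outermost rightward lo hi x i
  last {lo} {hi} {x} (p , rp , wp≡x) with lastOccurrence lo hi x
  ... | inj₁ found  = found
  ... | inj₂ absent = ⊥-elim (absent p rp wp≡x)

  outermost : ∀ d {lo hi x} → Occurs lo hi x → ∃[ i ] Outermost d lo hi x i
  outermost leftward  = first
  outermost rightward = last

  fullOrMissing : ∀ lo hi C → All (Occurs lo hi) C ⊎ ∃[ c ] (c ∈ C × Absent lo hi c)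
  fullOrMissing lo hi []      = inj₁ []
  fullOrMissing lo hi (c ∷ C) with firstOccurrence lo hi c | fullOrMissing lo hi C
  ... | inj₂ absent                 | _                       = inj₂ (c , here refl , absent)
  ... | inj₁ (i , ri , wi≡c , _)    | inj₁ full               = inj₁ ((i , ri , wi≡c) ∷ full)
  ... | inj₁ _                      | inj₂ (c' , c'∈C , absent) = inj₂ (c' , there c'∈C , absent)

  outermost-self : ∀ d {lo hi x i} → Outermost d lo hi x i → Outermost d lo hi (w i) i
  outermost-self d (ri , wi≡x , none) = ri , refl , λ p rp b wp≡wi → none p rp b (trans wp≡wi wi≡x)

  -- A prefix [lo , e] containing all letters of c ∷ D that ends with the
  -- first occurrence of the letter w e (e is the largest first occurrence).
  fullPrefix : ∀ {lo hi} c D → Occurs lo hi c → All (Occurs lo hi) D →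
    ∃[ e ] (Outermost leftward lo hi (w e) e × All (Occurs lo (suc e)) (c ∷ D))
  fullPrefix c [] occ [] with first occ
  ... | i , out@((lo≤i , _) , wi≡c , _) = i , outermost-self leftward out , (i , (lo≤i , n<1+n i) , wi≡c) ∷ []
  fullPrefix c (d ∷ D) occ (occ-d ∷ occ-D) with fullPrefix d D occ-d occ-D | first occ
  ... | e , out-e , occs | i , out-i@((lo≤i , _) , wi≡c , _) with i ≤? e
  ...   | yes i≤e = e , out-e , (i , (lo≤i , s≤s i≤e) , wi≡c) ∷ occs
  ...   | no  i≰e = i , outermost-self leftward out-i ,
                    (i , (lo≤i , n<1+n i) , wi≡c) ∷ All.map (occurs-extendʳ (<⇒≤ (s≤s (≰⇒> i≰e)))) occs

  fullSuffix : ∀ {lo hi} c D → Occurs lo hi c → All (Occurs lo hi) D →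
    ∃[ e ] (Outermost rightward lo hi (w e) e × All (Occurs e hi) (c ∷ D))
  fullSuffix c [] occ [] with last occ
  ... | i , out@((_ , i<hi) , wi≡c , _) = i , outermost-self rightward out , (i , (≤-refl , i<hi) , wi≡c) ∷ []
  fullSuffix c (d ∷ D) occ (occ-d ∷ occ-D) with fullSuffix d D occ-d occ-D | last occ
  ... | e , out-e , occs | i , out-i@((_ , i<hi) , wi≡c , _) with e ≤? i
  ...   | yes e≤i = e , out-e , (i , (e≤i , i<hi) , wi≡c) ∷ occs
  ...   | no  e≰i = i , outermost-self rightward out-i ,
                    (i , (≤-refl , i<hi) , wi≡c) ∷ All.map (occurs-extendˡ (<⇒≤ (≰⇒> e≰i))) occs

module Invariance (M : DAMonoid) {S : Set} (_≟_ : DecidableEquality S) (letter : S → DAMonoid.Carrier M)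
                  {N : ℕ} (code : DAMonoid.Carrier M → Fin N) (code-injective : Injective _≡_ _≡_ code) where
  open DAProperties M
  open Content letter
  open Pumping code code-injective
  open ≡-Reasoning

  ∏ : (ℕ → S) → ℕ → ℕ → Carrier
  ∏ w lo hi = prefixProduct (λ j → letter (w (lo + j))) (hi ∸ lo)

  LettersIn : (ℕ → S) → ℕ → ℕ → List S → Set
  LettersIn w lo hi C = ∀ p → Range lo hi p → w p ∈ C

  ∏-concat : ∀ w {lo i hi} → lo ≤ i → i ≤ hi → ∏ w lo hi ≡ ∏ w lo i * ∏ w i hi
  ∏-concat w {lo} lo≤i i≤hi with m≤n⇒∃[o]m+o≡n lo≤i | m≤n⇒∃[o]m+o≡n i≤hi
  ... | a , refl | b , refl = begin
    prefixProduct f (lo + a + b ∸ lo)                     ≡⟨ cong (prefixProduct f) length≡ ⟩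
    prefixProduct f (a + b)                               ≡⟨ prefixProduct-+ f a b ⟩
    prefixProduct f a * prefixProduct (λ j → f (a + j)) b ≡⟨ cong₂ _*_ first≡ second≡ ⟩
    ∏ w lo (lo + a) * ∏ w (lo + a) (lo + a + b)           ∎
    where
      f : ℕ → Carrier
      f j = letter (w (lo + j))
      length≡ : lo + a + b ∸ lo ≡ a + b
      length≡ = trans (cong (_∸ lo) (+-assoc lo a b)) (m+n∸m≡n lo (a + b))
      first≡ : prefixProduct f a ≡ ∏ w lo (lo + a)
      first≡ = cong (prefixProduct f) (sym (m+n∸m≡n lo a))
      second≡ : prefixProduct (λ j → f (a + j)) b ≡ ∏ w (lo + a) (lo + a + b)
      second≡ = trans (prefixProduct-cong (λ j → cong (letter ∘ w) (sym (+-assoc lo a j))) b)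
                      (cong (prefixProduct _) (sym (m+n∸m≡n (lo + a) b)))

  ∏-unit : ∀ w i → ∏ w i (suc i) ≡ letter (w i)
  ∏-unit w i = begin
    prefixProduct f (suc i ∸ i)   ≡⟨ cong (prefixProduct f) (trans (+-∸-assoc 1 (≤-refl {i})) (cong suc (n∸n≡0 i))) ⟩
    letter (w (i + 0)) * ε        ≡⟨ identityʳ _ ⟩
    letter (w (i + 0))            ≡⟨ cong (letter ∘ w) (+-identityʳ i) ⟩
    letter (w i)                  ∎
    where
      f : ℕ → Carrier
      f j = letter (w (i + j))

  ∏-empty : ∀ w {lo hi} → hi ≤ lo → ∏ w lo hi ≡ ε
  ∏-empty w hi≤lo = cong (prefixProduct _) (m≤n⇒m∸n≡0 hi≤lo)

  ∏-split-at : ∀ w {lo i hi} → lo ≤ i → i < hi → ∏ w lo hi ≡ ∏ w lo i * letter (w i) * ∏ w (suc i) hi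
  ∏-split-at w {lo} {i} {hi} lo≤i i<hi = begin
    ∏ w lo hi                                   ≡⟨ ∏-concat w (≤-trans lo≤i (n≤1+n i)) i<hi ⟩
    ∏ w lo (suc i) * ∏ w (suc i) hi             ≡⟨ cong (_* ∏ w (suc i) hi) (∏-concat w lo≤i (n≤1+n i)) ⟩
    ∏ w lo i * ∏ w i (suc i) * ∏ w (suc i) hi   ≡⟨ cong (λ x → ∏ w lo i * x * ∏ w (suc i) hi) (∏-unit w i) ⟩
    ∏ w lo i * letter (w i) * ∏ w (suc i) hi    ∎

  offset-in-range : ∀ {lo hi j} → j < hi ∸ lo → Range lo hi (lo + j)
  offset-in-range {lo} {hi} {j} j<hi-lo with lo ≤? hi
  ... | yes lo≤hi = m≤m+n lo j , subst (lo + j <_) (m+[n∸m]≡n lo≤hi) (+-monoʳ-< lo j<hi-lo)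
  ... | no  lo≰hi = ⊥-elim (n≮0 (subst (j <_) (m≤n⇒m∸n≡0 (<⇒≤ (≰⇒> lo≰hi))) j<hi-lo))

  ∏-generated : ∀ {w lo hi C} → LettersIn w lo hi C → Generated C (∏ w lo hi)
  ∏-generated letters-in = generated-prefixProduct (λ j j< → generated-letter (letters-in _ (offset-in-range j<)))

  ∏-contains : ∀ {w lo hi C} → All (Occurrences.Occurs _≟_ w lo hi) C → Contains C (∏ w lo hi)
  ∏-contains {w} {lo} {hi} occs c c∈C with All.lookup occs c∈C
  ... | p , (lo≤p , p<hi) , wp≡c =
    ∏ w lo p , ∏ w (suc p) hi , trans (∏-split-at w lo≤p p<hi) (cong (λ x → ∏ w lo p * letter x * ∏ w (suc p) hi) wp≡c)

  ∏-cons : ∀ w {i hi} → i < hi → ∏ w i hi ≡ letter (w i) * ∏ w (suc i) hi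
  ∏-cons w {i} {hi} i<hi = begin
    ∏ w i hi                                   ≡⟨ ∏-split-at w ≤-refl i<hi ⟩
    ∏ w i i * letter (w i) * ∏ w (suc i) hi    ≡⟨ cong (λ x → x * letter (w i) * ∏ w (suc i) hi) (∏-empty w (≤-refl {i})) ⟩
    ε * letter (w i) * ∏ w (suc i) hi          ≡⟨ cong (_* ∏ w (suc i) hi) (identityˡ _) ⟩
    letter (w i) * ∏ w (suc i) hi              ∎

  ∏-snoc : ∀ w {lo i} → lo ≤ i → ∏ w lo (suc i) ≡ ∏ w lo i * letter (w i)
  ∏-snoc w {lo} {i} lo≤i = trans (∏-concat w lo≤i (n≤1+n i)) (cong (∏ w lo i *_) (∏-unit w i))

  -- rounds sufficient for words over at most m letters
  rounds : ℕ → ℕ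
  rounds zero    = 0
  rounds (suc m) = rounds m + (N + N)

  module OnWords (u v : ℕ → S) where
    open Game u v
    module Oᵘ = Occurrences _≟_ u
    module Oᵛ = Occurrences _≟_ v

    Settled : ℕ → ℕ → ℕ → ℕ → Set
    Settled lo hi lo' hi' = ∏ u lo hi ≡ ∏ v lo' hi'

    Invariant : ℕ → Set
    Invariant m = ∀ C → length C ≤ m → ∀ {lo hi lo' hi'} → LettersIn u lo hi C →
      Equiv (Range lo hi) (Range lo' hi') (rounds m) → Settled lo hi lo' hi'

    letters-transfer : ∀ {lo hi lo' hi' C k} → LettersIn u lo hi C →
      Equiv (Range lo hi) (Range lo' hi') k → LettersIn v lo' hi' C
    letters-transfer {C = C} letters (_ , back) q rq with back q rq
    ... | p , rp , up≡vq , _ = subst (_∈ C) up≡vq (letters p rp)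

    settled-if-empty : ∀ {lo hi lo' hi' k} → hi ≤ lo → Equiv (Range lo hi) (Range lo' hi') k → Settled lo hi lo' hi'
    settled-if-empty {lo} {hi} {lo'} {hi'} hi≤lo (_ , back) with lo' <? hi'
    ... | no  lo'≮hi' = trans (∏-empty u hi≤lo) (sym (∏-empty v (≮⇒≥ lo'≮hi')))
    ... | yes lo'<hi' with back lo' (≤-refl , lo'<hi')
    ...   | p , (lo≤p , p<hi) , _ = ⊥-elim (<⇒≱ (≤-<-trans lo≤p p<hi) hi≤lo)

    partner : ∀ d {k lo hi lo' hi' e} → Equiv (Range lo hi) (Range lo' hi') k → Range lo hi e →
      ∃[ j ] Oᵛ.Outermost d lo' hi' (u e) j
    partner d (forth , _) re with forth _ re
    ... | q , rq , ue≡vq , _ = Oᵛ.outermost d (q , rq , sym ue≡vq)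

    invariant-zero : Invariant 0
    invariant-zero [] _ {lo} {hi} letters eqv with lo <? hi
    ... | no  lo≮hi = settled-if-empty (≮⇒≥ lo≮hi) eqv
    ... | yes lo<hi with letters lo (≤-refl , lo<hi)
    ...   | ()

    module Step (m : ℕ) (ih : Invariant m) (C : List S) (|C|≤1+m : length C ≤ suc m) where

      -- a letter of C that does not occur leaves at most m letters
      without-letter : ∀ {c lo hi lo' hi' r} → c ∈ C → Oᵘ.Absent lo hi c → rounds m ≤ r →
        LettersIn u lo hi C → Equiv (Range lo hi) (Range lo' hi') r → Settled lo hi lo' hi'
      without-letter {c} c∈C absent r≥ letters eqv = ih (filter ≢c? C) fewer letters' (Equiv-≤ r≥ eqv)
        where
          ≢c? : (y : S) → Dec (c ≢ y)
          ≢c? y = ¬? (c ≟ y)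
          fewer : length (filter ≢c? C) ≤ m
          fewer = ≤-pred (<-≤-trans (filter-notAll ≢c? C (Any.map (λ c≡y c≢y → c≢y c≡y) c∈C)) |C|≤1+m)
          letters' : LettersIn u _ _ (filter ≢c? C)
          letters' p rp = ∈-filter⁺ ≢c? (letters p rp) (λ c≡up → absent p rp (sym c≡up))

      record LeftPeeled (t r lo hi lo' hi' : ℕ) : Set where
        field
          block    : ℕ → Carrier
          blocks   : Blocks C block t
          lo₁ lo₁' : ℕ
          letters  : LettersIn u lo₁ hi C
          equiv    : Equiv (Range lo₁ hi) (Range lo₁' hi') r
          splitᵘ   : ∏ u lo hi ≡ prefixProduct block t * ∏ u lo₁ hi
          splitᵛ   : ∏ v lo' hi' ≡ prefixProduct block t * ∏ v lo₁' hi'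

        settled : Settled lo₁ hi lo₁' hi' → Settled lo hi lo' hi'
        settled eq = trans splitᵘ (trans (cong (prefixProduct block t *_) eq) (sym splitᵛ))

      record RightPeeled (t r lo hi lo' hi' : ℕ) : Set where
        field
          block    : ℕ → Carrier
          blocks   : Blocks C block t
          hi₁ hi₁' : ℕ
          letters  : LettersIn u lo hi₁ C
          equiv    : Equiv (Range lo hi₁) (Range lo' hi₁') r
          splitᵘ   : ∏ u lo hi ≡ ∏ u lo hi₁ * suffixProduct block t
          splitᵛ   : ∏ v lo' hi' ≡ ∏ v lo' hi₁' * suffixProduct block t

        settled : Settled lo hi₁ lo' hi₁' → Settled lo hi lo' hi'
        settled eq = trans splitᵘ (trans (cong (_* suffixProduct block t) eq) (sym splitᵛ))

      -- One round cuts off a prefix [lo , e] of u containing all of C whose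
      -- last letter u e occurs first at e: cutting u at e and v at the first
      -- occurrence j of u e leaves prefixes without u e, settled by induction.
      peelLeft : ∀ {r lo hi lo' hi'} → rounds m ≤ r → LettersIn u lo hi C →
        Equiv (Range lo hi) (Range lo' hi') (suc r) → Settled lo hi lo' hi' ⊎ LeftPeeled 1 r lo hi lo' hi'
      peelLeft {r} {lo} {hi} {lo'} {hi'} r≥ letters eqv with lo <? hi
      ... | no lo≮hi = inj₁ (settled-if-empty (≮⇒≥ lo≮hi) eqv)
      ... | yes lo<hi with Oᵘ.fullOrMissing lo hi C
      ...   | inj₂ (c , c∈C , absent) = inj₁ (without-letter c∈C absent (m≤n⇒m≤1+n r≥) letters eqv)
      ...   | inj₁ full with Oᵘ.fullPrefix (u lo) C (lo , (≤-refl , lo<hi) , refl) full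
      ...     | e , (re@(lo≤e , e<hi) , _ , none-e) , _ ∷ occs with partner leftward eqv re
      ...       | j , rj@(lo'≤j , j<hi') , vj≡ue , none-j with cut u v leftward re rj (sym vj≡ue) none-e none-j eqv
      ...         | equiv-prefix , equiv-rest = inj₂ (record
        { block   = λ _ → b
        ; blocks  = λ _ _ → contains-b , generated-b
        ; lo₁     = suc e
        ; lo₁'    = suc j
        ; letters = λ p (e<p , p<hi) → letters p (≤-trans lo≤e (<⇒≤ e<p) , p<hi)
        ; equiv   = equiv-rest
        ; splitᵘ  = trans (∏-split-at u lo≤e e<hi) (cong (_* ∏ u (suc e) hi) (sym (identityʳ b)))
        ; splitᵛ  = splitᵛ
        })
        where
          b : Carrier
          b = ∏ u lo e * letter (u e)
          letters-prefix : LettersIn u lo e C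
          letters-prefix p (lo≤p , p<e) = letters p (lo≤p , <-trans p<e e<hi)
          prefix-settled : Settled lo e lo' j
          prefix-settled = without-letter (letters e re) (λ p (lo≤p , p<e) → none-e p (lo≤p , <-trans p<e e<hi) p<e)
                             r≥ letters-prefix equiv-prefix
          contains-b : Contains C b
          contains-b = subst (Contains C) (∏-snoc u lo≤e) (∏-contains occs)
          generated-b : Generated C b
          generated-b = generated-* (∏-generated letters-prefix) (generated-letter (letters e re))
          splitᵛ : ∏ v lo' hi' ≡ b * ε * ∏ v (suc j) hi'
          splitᵛ = begin
            ∏ v lo' hi'                                ≡⟨ ∏-split-at v lo'≤j j<hi' ⟩
            ∏ v lo' j * letter (v j) * ∏ v (suc j) hi' ≡⟨ cong₂ (λ x y → x * letter y * ∏ v (suc j) hi') (sym prefix-settled) vj≡ue ⟩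
            b * ∏ v (suc j) hi'                        ≡⟨ cong (_* ∏ v (suc j) hi') (sym (identityʳ b)) ⟩
            b * ε * ∏ v (suc j) hi'                    ∎

      peelRight : ∀ {r lo hi lo' hi'} → rounds m ≤ r → LettersIn u lo hi C →
        Equiv (Range lo hi) (Range lo' hi') (suc r) → Settled lo hi lo' hi' ⊎ RightPeeled 1 r lo hi lo' hi'
      peelRight {r} {lo} {hi} {lo'} {hi'} r≥ letters eqv with lo <? hi
      ... | no lo≮hi = inj₁ (settled-if-empty (≮⇒≥ lo≮hi) eqv)
      ... | yes lo<hi with Oᵘ.fullOrMissing lo hi C
      ...   | inj₂ (c , c∈C , absent) = inj₁ (without-letter c∈C absent (m≤n⇒m≤1+n r≥) letters eqv)
      ...   | inj₁ full with Oᵘ.fullSuffix (u lo) C (lo , (≤-refl , lo<hi) , refl) full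
      ...     | e , (re@(lo≤e , e<hi) , _ , none-e) , _ ∷ occs with partner rightward eqv re
      ...       | j , rj@(lo'≤j , j<hi') , vj≡ue , none-j with cut u v rightward re rj (sym vj≡ue) none-e none-j eqv
      ...         | equiv-rest , equiv-suffix = inj₂ (record
        { block   = λ _ → b
        ; blocks  = λ _ _ → contains-b , generated-b
        ; hi₁     = e
        ; hi₁'    = j
        ; letters = λ p (lo≤p , p<e) → letters p (lo≤p , <-trans p<e e<hi)
        ; equiv   = equiv-rest
        ; splitᵘ  = trans (∏-split-at u lo≤e e<hi) (trans (assoc _ _ _) (cong (∏ u lo e *_) (sym (identityˡ b))))
        ; splitᵛ  = splitᵛ
        })
        where
          b : Carrier
          b = letter (u e) * ∏ u (suc e) hi
          letters-suffix : LettersIn u (suc e) hi C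
          letters-suffix p (e<p , p<hi) = letters p (≤-trans lo≤e (<⇒≤ e<p) , p<hi)
          suffix-settled : Settled (suc e) hi (suc j) hi'
          suffix-settled = without-letter (letters e re) (λ p (e<p , p<hi) → none-e p (≤-trans lo≤e (<⇒≤ e<p) , p<hi) e<p)
                             r≥ letters-suffix equiv-suffix
          contains-b : Contains C b
          contains-b = subst (Contains C) (∏-cons u e<hi) (∏-contains occs)
          generated-b : Generated C b
          generated-b = generated-* (generated-letter (letters e re)) (∏-generated letters-suffix)
          splitᵛ : ∏ v lo' hi' ≡ ∏ v lo' j * (ε * b)
          splitᵛ = begin
            ∏ v lo' hi'                                  ≡⟨ ∏-split-at v lo'≤j j<hi' ⟩
            ∏ v lo' j * letter (v j) * ∏ v (suc j) hi'   ≡⟨ assoc _ _ _ ⟩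
            ∏ v lo' j * (letter (v j) * ∏ v (suc j) hi') ≡⟨ cong₂ (λ x y → ∏ v lo' j * (letter x * y)) vj≡ue (sym suffix-settled) ⟩
            ∏ v lo' j * b                                ≡⟨ cong (∏ v lo' j *_) (sym (identityˡ b)) ⟩
            ∏ v lo' j * (ε * b)                          ∎

      glueˡ : ∀ {x a y p z} → x ≡ a * ε * y → y ≡ p * z → x ≡ a * p * z
      glueˡ {x} {a} {y} {p} {z} x≡ y≡ = begin
        x             ≡⟨ x≡ ⟩
        a * ε * y     ≡⟨ cong (_* y) (identityʳ a) ⟩
        a * y         ≡⟨ cong (a *_) y≡ ⟩
        a * (p * z)   ≡⟨ sym (assoc _ _ _) ⟩
        a * p * z     ∎

      glueʳ : ∀ {x a y s z} → x ≡ y * (ε * a) → y ≡ z * s → x ≡ z * (s * a)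
      glueʳ {x} {a} {y} {s} {z} x≡ y≡ = begin
        x             ≡⟨ x≡ ⟩
        y * (ε * a)   ≡⟨ cong (y *_) (identityˡ a) ⟩
        y * a         ≡⟨ cong (_* a) y≡ ⟩
        z * s * a     ≡⟨ assoc _ _ _ ⟩
        z * (s * a)   ∎

      peelLeft* : ∀ t {r lo hi lo' hi'} → rounds m ≤ r → LettersIn u lo hi C →
        Equiv (Range lo hi) (Range lo' hi') (r + t) → Settled lo hi lo' hi' ⊎ LeftPeeled t r lo hi lo' hi'
      peelLeft* zero {r} {lo} {lo' = lo'} _ letters eqv = inj₂ (record
        { block = λ _ → ε ; blocks = λ _ () ; lo₁ = lo ; lo₁' = lo' ; letters = letters
        ; equiv = subst (Equiv _ _) (+-identityʳ r) eqv
        ; splitᵘ = sym (identityˡ _) ; splitᵛ = sym (identityˡ _) })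
      peelLeft* (suc t) {r} r≥ letters eqv
        with peelLeft (≤-trans r≥ (m≤m+n r t)) letters (subst (Equiv _ _) (+-suc r t) eqv)
      ... | inj₁ settled = inj₁ settled
      ... | inj₂ first with peelLeft* t r≥ (LeftPeeled.letters first) (LeftPeeled.equiv first)
      ...   | inj₁ settled = inj₁ (LeftPeeled.settled first settled)
      ...   | inj₂ rest = inj₂ (record
        { block   = λ { zero → F.block 0 ; (suc i) → R.block i }
        ; blocks  = λ { zero _ → F.blocks 0 (s≤s z≤n) ; (suc i) (s≤s i<t) → R.blocks i i<t }
        ; lo₁     = R.lo₁
        ; lo₁'    = R.lo₁'
        ; letters = R.letters
        ; equiv   = R.equiv
        ; splitᵘ  = glueˡ F.splitᵘ R.splitᵘ
        ; splitᵛ  = glueˡ F.splitᵛ R.splitᵛ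
        })
        where
          module F = LeftPeeled first
          module R = LeftPeeled rest

      peelRight* : ∀ t {r lo hi lo' hi'} → rounds m ≤ r → LettersIn u lo hi C →
        Equiv (Range lo hi) (Range lo' hi') (r + t) → Settled lo hi lo' hi' ⊎ RightPeeled t r lo hi lo' hi'
      peelRight* zero {r} {hi = hi} {hi' = hi'} _ letters eqv = inj₂ (record
        { block = λ _ → ε ; blocks = λ _ () ; hi₁ = hi ; hi₁' = hi' ; letters = letters
        ; equiv = subst (Equiv _ _) (+-identityʳ r) eqv
        ; splitᵘ = sym (identityʳ _) ; splitᵛ = sym (identityʳ _) })
      peelRight* (suc t) {r} r≥ letters eqv
        with peelRight (≤-trans r≥ (m≤m+n r t)) letters (subst (Equiv _ _) (+-suc r t) eqv)
      ... | inj₁ settled = inj₁ settled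
      ... | inj₂ first with peelRight* t r≥ (RightPeeled.letters first) (RightPeeled.equiv first)
      ...   | inj₁ settled = inj₁ (RightPeeled.settled first settled)
      ...   | inj₂ rest = inj₂ (record
        { block   = λ { zero → F.block 0 ; (suc i) → R.block i }
        ; blocks  = λ { zero _ → F.blocks 0 (s≤s z≤n) ; (suc i) (s≤s i<t) → R.blocks i i<t }
        ; hi₁     = R.hi₁
        ; hi₁'    = R.hi₁'
        ; letters = R.letters
        ; equiv   = R.equiv
        ; splitᵘ  = glueʳ F.splitᵘ R.splitᵘ
        ; splitᵛ  = glueʳ F.splitᵛ R.splitᵛ
        })
        where
          module F = RightPeeled first
          module R = RightPeeled rest

      -- N blocks on the left and N on the right make both products stable,
      -- so the remaining middle parts (over C) do not matter.
      invariant-step : ∀ {lo hi lo' hi'} → LettersIn u lo hi C →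
        Equiv (Range lo hi) (Range lo' hi') (rounds (suc m)) → Settled lo hi lo' hi'
      invariant-step {lo} {hi} {lo'} {hi'} letters eqv
        with peelLeft* N (m≤m+n (rounds m) N) letters (subst (Equiv _ _) (sym (+-assoc (rounds m) N N)) eqv)
      ... | inj₁ settled = settled
      ... | inj₂ left with peelRight* N ≤-refl (LeftPeeled.letters left) (LeftPeeled.equiv left)
      ...   | inj₁ settled = LeftPeeled.settled left settled
      ...   | inj₂ right = begin
        ∏ u lo hi                       ≡⟨ L.splitᵘ ⟩
        P * ∏ u L.lo₁ hi                ≡⟨ cong (P *_) R.splitᵘ ⟩
        P * (∏ u L.lo₁ R.hi₁ * Q)       ≡⟨ stable-context (prefix-stable L.blocks) (suffix-stable R.blocks)
                                             (∏-generated R.letters) (∏-generated (letters-transfer R.letters R.equiv)) ⟩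
        P * (∏ v L.lo₁' R.hi₁' * Q)     ≡⟨ cong (P *_) (sym R.splitᵛ) ⟩
        P * ∏ v L.lo₁' hi'              ≡⟨ sym L.splitᵛ ⟩
        ∏ v lo' hi'                     ∎
        where
          module L = LeftPeeled left
          module R = RightPeeled right
          P Q : Carrier
          P = prefixProduct L.block N
          Q = suffixProduct R.block N

    invariant : ∀ m → Invariant m
    invariant zero    = invariant-zero
    invariant (suc m) C |C|≤1+m = Step.invariant-step m (invariant m) C |C|≤1+m

module AdjoinUnit (FA : ForestAlgebra) where
  open ForestAlgebra FA using (H; mulH) renaming (_+_ to _⊕ᴴ_; +-assoc to ⊕ᴴ-assoc)

  infixl 7 _⊹_
  _⊹_ : Maybe H → Maybe H → Maybe H
  just a  ⊹ just b  = just (a ⊕ᴴ b)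
  just a  ⊹ nothing = just a
  nothing ⊹ y       = y

  ⊹-assoc : ∀ x y z → x ⊹ y ⊹ z ≡ x ⊹ (y ⊹ z)
  ⊹-assoc nothing  y        z        = refl
  ⊹-assoc (just a) nothing  z        = refl
  ⊹-assoc (just a) (just b) nothing  = refl
  ⊹-assoc (just a) (just b) (just c) = cong just (⊕ᴴ-assoc a b c)

  ⊹-identityʳ : ∀ x → x ⊹ nothing ≡ x
  ⊹-identityʳ nothing  = refl
  ⊹-identityʳ (just a) = refl

  open Powers _⊹_ nothing ⊹-assoc (λ _ → refl) ⊹-identityʳ

  ^-just : ∀ h n → just h ^ suc n ≡ just (mulH (suc n) h)
  ^-just h zero    = refl
  ^-just h (suc n) = cong (just h ⊹_) (^-just h n)

  ^-nothing : ∀ n → nothing ^ n ≡ nothing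
  ^-nothing zero    = refl
  ^-nothing (suc n) = ^-nothing n

  H¹ : ∀ k → (∀ h → mulH (suc k) h ⊕ᴴ mulH (suc k) h ≡ mulH (suc k) h) → HIdentity FA (suc k) → DAMonoid
  H¹ k ω-idempotentᴴ h-identity = record
    { Carrier = Maybe H ; _*_ = _⊹_ ; ε = nothing
    ; assoc = ⊹-assoc ; identityˡ = λ _ → refl ; identityʳ = ⊹-identityʳ
    ; ω = suc k ; ω-idempotent = ω-idempotent ; da-identity = da-identity }
    where
      ω-idempotent : ∀ x → x ^ suc k ⊹ x ^ suc k ≡ x ^ suc k
      ω-idempotent nothing  rewrite ^-nothing k = refl
      ω-idempotent (just h) rewrite ^-just h k  = cong just (ω-idempotentᴴ h)

      ^ω-square : ∀ x → (x ⊹ x) ^ suc k ≡ x ^ suc k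
      ^ω-square x = trans (^-square x (suc k)) (trans (^-homo-+ x (suc k) (suc k)) (ω-idempotent x))

      da-just : ∀ a b → (just a ⊹ just b) ^ suc k ⊹ just b ⊹ (just a ⊹ just b) ^ suc k ≡ (just a ⊹ just b) ^ suc k
      da-just a b rewrite ^-just (a ⊕ᴴ b) k = cong just (h-identity a b)

      da-identity : ∀ x y → (x ⊹ y) ^ suc k ⊹ y ⊹ (x ⊹ y) ^ suc k ≡ (x ⊹ y) ^ suc k
      da-identity (just a) (just b) = da-just a b
      da-identity (just a) nothing  rewrite ^-just a k = cong just (ω-idempotentᴴ a)
      da-identity nothing  nothing  rewrite ^-nothing k = refl
      da-identity nothing  (just b) = subst (λ e → e ⊹ just b ⊹ e ≡ e) (^ω-square (just b)) (da-just b b)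

module Enumeration {H : Set} {n : ℕ} (enum : Fin n ↔ H) where
  open Inverse enum

  from-injective : ∀ {a b} → from a ≡ from b → a ≡ b
  from-injective {a} {b} e = trans (sym (strictlyInverseˡ a)) (trans (cong to e) (strictlyInverseˡ b))

  _≟ᴴ_ : DecidableEquality H
  a ≟ᴴ b with from a Finₚ.≟ from b
  ... | yes e = yes (from-injective e)
  ... | no ne = no (λ e → ne (cong from e))

  code : Maybe H → Fin (suc n)
  code nothing  = Fin.zero
  code (just h) = Fin.suc (from h)

  code-injective : Injective _≡_ _≡_ code
  code-injective {nothing} {nothing} _ = refl
  code-injective {just a}  {just b}  e = cong just (from-injective (Finₚ.suc-injective e))

  elements : List H
  elements = tabulate to

  length-elements : length elements ≡ n
  length-elements = length-tabulate to

  ∈-elements : ∀ h → h ∈ elements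
  ∈-elements h = subst (_∈ elements) (strictlyInverseˡ h) (∈-tabulate⁺ (from h))

-- position i of the list x ∷ xs (its last letter beyond its end)
nth : {L : Set} → L → List L → ℕ → L
nth x xs       zero    = x
nth x []       (suc i) = x
nth x (y ∷ ys) (suc i) = nth y ys i

lookup-nth : ∀ {L : Set} (x : L) xs (i : Fin (length (x ∷ xs))) → lookup (x ∷ xs) i ≡ nth x xs (toℕ i)
lookup-nth x xs       Fin.zero    = refl
lookup-nth x (y ∷ ys) (Fin.suc i) = lookup-nth y ys i

in-range : ∀ {m} (i : Fin m) → Range 0 m (toℕ i)
in-range i = z≤n , Finₚ.toℕ<n i

position : ∀ {m} p → p < m → ∃[ i ] (toℕ {m} i ≡ p)
position p p<m = Fin.fromℕ< p<m , Finₚ.toℕ-fromℕ< p<m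

module SiblingPatterns {A B : Set} (FA : ForestAlgebra) {n : ℕ} (enum : Fin n ↔ ForestAlgebra.H FA)
  (α : Morphism A B FA) (k : ℕ)
  (ω-idempotentᴴ : ∀ h → ForestAlgebra._+_ FA (ForestAlgebra.mulH FA (suc k) h) (ForestAlgebra.mulH FA (suc k) h)
                           ≡ ForestAlgebra.mulH FA (suc k) h)
  (h-identity : HIdentity FA (suc k)) where
  open ForestAlgebra FA using (H)
  open Morphism α using (fH; hom-+)
  open Enumeration enum
  open AdjoinUnit FA using (_⊹_; H¹)
  open Invariance (H¹ k ω-idempotentᴴ h-identity) _≟ᴴ_ just code code-injective

  -- one round to reach all positions from the first ones, then the
  -- rounds needed for words over the n elements of H
  rank : ℕ
  rank = suc (rounds n)

  type : Forest A B → Letter A B → H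
  type s l = fH [ letterTree l s ]

  word : Forest A B → Letter A B → List (Letter A B) → ℕ → H
  word s x xs = type s ∘ nth x xs

  fill-product : ∀ s x xs → ∏ (word s x xs) 0 (suc (length xs)) ≡ just (fH (fillL x xs s))
  fill-product s x []       = refl
  fill-product s x (y ∷ ys) =
    trans (cong (just (type s x) ⊹_) (fill-product s y ys)) (cong just (sym (hom-+ [ letterTree x s ] (fillL y ys s))))

  module Pair (s : Forest A B) (x : Letter A B) (xs : List (Letter A B)) (y : Letter A B) (ys : List (Letter A B)) where
    open Game (word s x xs) (word s y ys)

    U V : ℕ → Set
    U = Range 0 (suc (length xs))
    V = Range 0 (suc (length ys))

    same-type : ∀ i j → lookup (x ∷ xs) i ≡ lookup (y ∷ ys) j → word s x xs (toℕ i) ≡ word s y ys (toℕ j)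
    same-type i j e = cong (type s) (trans (sym (lookup-nth x xs i)) (trans e (lookup-nth y ys j)))

    win→game : ∀ k i j → Win (x ∷ xs) (y ∷ ys) k i j → G U V k (toℕ i) (toℕ j)

    forth : ∀ k d {i : Fin (length (x ∷ xs))} {j : Fin (length (y ∷ ys))} →
      (∀ i' → Beyond d (toℕ i) (toℕ i') →
         ∃[ j' ] (Beyond d (toℕ j) (toℕ j') × lookup (x ∷ xs) i' ≡ lookup (y ∷ ys) j' × Win (x ∷ xs) (y ∷ ys) k i' j')) →
      ∀ p' → U p' → Beyond d (toℕ i) p' →
        ∃[ q' ] (V q' × Beyond d (toℕ j) q' × word s x xs p' ≡ word s y ys q' × G U V k p' q')
    forth k d move p' (_ , p'<) b with position p' p'<
    ... | i' , refl with move i' b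
    ...   | j' , b' , e , win = toℕ j' , in-range j' , b' , same-type i' j' e , win→game k i' j' win

    back : ∀ k d {i : Fin (length (x ∷ xs))} {j : Fin (length (y ∷ ys))} →
      (∀ j' → Beyond d (toℕ j) (toℕ j') →
         ∃[ i' ] (Beyond d (toℕ i) (toℕ i') × lookup (x ∷ xs) i' ≡ lookup (y ∷ ys) j' × Win (x ∷ xs) (y ∷ ys) k i' j')) →
      ∀ q' → V q' → Beyond d (toℕ j) q' →
        ∃[ p' ] (U p' × Beyond d (toℕ i) p' × word s x xs p' ≡ word s y ys q' × G U V k p' q')
    back k d move q' (_ , q'<) b with position q' q'<
    ... | j' , refl with move j' b
    ...   | i' , b' , e , win = toℕ i' , in-range i' , b' , same-type i' j' e , win→game k i' j' win

    win→game zero    i j _ = tt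
    win→game (suc k) i j (left-u , right-u , left-v , right-v) leftward  = forth k leftward left-u , back k leftward left-v
    win→game (suc k) i j (left-u , right-u , left-v , right-v) rightward = forth k rightward right-u , back k rightward right-v

    -- from the first positions, every position is reached by one rightward move
    equiv : ∀ k → EquivK (suc k) (x ∷⁺ xs) (y ∷⁺ ys) → Equiv U V k
    equiv k (first-same , win) = forth-all , back-all
      where
        g : G U V (suc k) 0 0
        g = win→game (suc k) Fin.zero Fin.zero win
        forth-all : ∀ p → U p → ∃[ q ] (V q × word s x xs p ≡ word s y ys q × G U V k p q)
        forth-all zero    _  = 0 , (z≤n , s≤s z≤n) , cong (type s) first-same , G-≤ (n≤1+n k) g
        forth-all (suc p) up with proj₁ (g rightward) (suc p) up (s≤s z≤n)
        ... | q , vq , _ , e , g' = q , vq , e , g'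
        back-all : ∀ q → V q → ∃[ p ] (U p × word s x xs p ≡ word s y ys q × G U V k p q)
        back-all zero    _  = 0 , (z≤n , s≤s z≤n) , cong (type s) first-same , G-≤ (n≤1+n k) g
        back-all (suc q) vq with proj₂ (g rightward) (suc q) vq (s≤s z≤n)
        ... | p , up , _ , e , g' = p , up , e , g'

  pattern-invariance : ∀ r → rank ≤ r → ∀ (p p' : Pattern A B) → EquivK r p p' → ∀ s → fH (fill p s) ≡ fH (fill p' s)
  pattern-invariance (suc r) (s≤s rounds≤r) (x ∷⁺ xs) (y ∷⁺ ys) eqv s = just-injective (begin
    just (fH (fillL x xs s))            ≡⟨ sym (fill-product s x xs) ⟩
    ∏ (word s x xs) 0 (suc (length xs)) ≡⟨ OnWords.invariant (word s x xs) (word s y ys) n elements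
                                             (≤-reflexive length-elements) (λ p _ → ∈-elements _)
                                             (Game.Equiv-≤ _ _ rounds≤r (Pair.equiv s x xs y ys r eqv)) ⟩
    ∏ (word s y ys) 0 (suc (length ys)) ≡⟨ fill-product s y ys ⟩
    just (fH (fillL y ys s))            ∎)
    where open ≡-Reasoning

-- ω is positive, so ω = k + 1 and the lemma is an instance of
-- pattern-invariance.
lemma8p1 : {A B : Set} → Finite A → Finite B →
    (FA : ForestAlgebra) → FiniteFA FA →
    (α : Morphism A B FA) →
    (ω : ℕ) → IsOmega FA ω →
    HIdentity FA ω → VIdentity FA ω →
    (Σ (Morphism (A ⊎ᴴ FA) B FA) λ β → IsLeafCompletion α β × ClosedUnderSaturation ω β) →
    ∃[ k' ] (∀ k → k' ≤ k → ∀ (p p' : Pattern A B) → IsSibPattern p → IsSibPattern p' →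
    EquivK k p p' → ∀ (s : Forest A B) →
    Morphism.fH α (fill p s) ≡ Morphism.fH α (fill p' s))
lemma8p1 _ _ FA ((n , enum) , _) α zero    (() , _) _ _ _
lemma8p1 _ _ FA ((n , enum) , _) α (suc k) (_ , _ , ω-idempotentᴴ) h-identity _ _ =
  rank , λ r rank≤r p p' _ _ → pattern-invariance r rank≤r p p'
  where open SiblingPatterns FA enum α k ω-idempotentᴴ h-identity
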